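{- Let $B=B'(p)$ be an integral base-polyhedron on ground-set $S$, and let $\{S_1,\dots,S_q\}$, $\beta_1>\dots>\beta_q$, $p_i$ ($i=1,\dots,q$) be the canonical partition, essential value-sequence and the functions defined in the context. For $i=1,\dots,q$ let $B_i:=B'(p_i)\subseteq\mathbb{R}^{S_i}$ and $T_i:=\{x\in\mathbb{R}^{S_i}:\beta_i-1\le x(s)\le\beta_i\ \forall s\in S_i\}$. Let $B^{\oplus}$ be the direct sum of the $B_i$ (i.e. $\{x\in\mathbb{R}^S: x|S_i\in B_i\ \forall i\}$), $T^*$ the direct sum of the $T_i$, and $B^\bullet:=B^\oplus\cap T^*$. Then the set of decreasingly minimal elements of $B\cap\mathbb{Z}^S$ is $B^\bullet\cap\mathbb{Z}^S$. Equivalently, $m\in B\cap\mathbb{Z}^S$ is decreasingly minimal if and only if $m|S_i\in B_i\cap T_i$ for each $i=1,\dots,q$.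
   Context: $S$ is a finite non-empty set; $p$ is a set-function on subsets of $S$ with values in $\mathbb{Z}\cup\{ -\infty\}$, $p(\emptyset)=0$, $p(S)$ finite, and supermodular: $p(X)+p(Y)\le p(X\cap Y)+p(X\cup Y)$ whenever $p(X),p(Y)$ are finite. For a ground set $U$ and such a function $q$, $B'(q)=\{x\in\mathbb{R}^U:\widetilde x(U)=q(U),\ \widetilde x(Z)\ge q(Z)\ \forall Z\subset U\}$, $\widetilde x(Z)=\sum_{s\in Z}x(s)$. Canonical partition: set $C_0=\emptyset$; for $j=1,2,\dots$ while $C_{j-1}\ne S$, let $\beta_j:=\max\{\lceil (p(X\cup C_{j-1})-p(C_{j-1}))/|X|\rceil:\emptyset\neq X\subseteq S-C_{j-1}\}$, $h_j(X):=p(X\cup C_{j-1})-p(C_{j-1})-(\beta_j-1)|X|$ for $X\subseteq S-C_{j-1}$, let $S_j$ be the intersection of all maximizers of $h_j$ (a non-empty set), and $C_j:=C_{j-1}\cup S_j$; $q$ is the index with $C_q=S$. Then $\beta_1>\beta_2>\dots>\beta_q$ is the essential value-sequence, $\{S_1,\dots,S_q\}$ the canonical partition, $\{C_1,\dots,C_q\}$ the canonical chain, and $p_i(X):=p(X\cup C_{i-1})-p(C_{i-1})$ for $X\subseteq S_i$. With $x{\downarrow}$ the decreasing rearrangement of $x$, $m$ is decreasingly minimal in $B\cap\mathbb{Z}^S$ if for every $y$ in it, $m{\downarrow}=y{\downarrow}$ or $m{\downarrow}(j)<y{\downarrow}(j)$ at the first index where they differ. -}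

module Defs where

open import Data.Nat as ℕ using (ℕ; zero; suc)
open import Data.Integer as ℤ
  using (ℤ; +_; _+_; _-_; -_; _*_; _/ℕ_; _≤_; _<_; 0ℤ; 1ℤ)
open import Data.Fin using (Fin; zero; suc; cast)
open import Data.Vec using (Vec; []; _∷_; toList)
open import Data.Vec.Functional using (fromVec)
open import Data.Fin.Subset
  using (Subset; Side; inside; outside; _∈_; _⊆_; _∩_; _∪_; ∁; ∣_∣; Nonempty)
open import Data.List using (List; length)
open import Data.Product using (_×_; ∃; ∃-syntax; Σ-syntax; _,_)
open import Data.Sum using (_⊎_)
open import Relation.Binary.PropositionalEquality using (_≡_; sym; trans)
open import Function.Bundles using (_⇔_)
open import Data.Integer.Properties using (≤-decTotalOrder)
import Relation.Binary.Construct.Flip.EqAndOrd as Flip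
import Data.List.Sort as Sort
open import Data.List.Relation.Binary.Permutation.Propositional.Properties
  using (↭-length)
open import Data.Vec.Properties using (length-toList)

data ℤ∞ : Set where
  -∞  : ℤ∞
  fin : ℤ → ℤ∞

infix 4 _≤∞_
data _≤∞_ : ℤ∞ → ℤ∞ → Set where
  -∞≤  : ∀ {e} → -∞ ≤∞ e
  fin≤ : ∀ {a b} → a ≤ b → fin a ≤∞ fin b

infixl 6 _+∞_
_+∞_ : ℤ∞ → ℤ∞ → ℤ∞
fin a +∞ fin b = fin (a + b)
_     +∞ _     = -∞

-- difference e − f ; only ever used with f finite
-- (convention: the result is -∞ if either argument is -∞)
diff∞ : ℤ∞ → ℤ∞ → ℤ∞
diff∞ (fin a) (fin b) = fin (a - b)
diff∞ _       _       = -∞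

-- ⌈ e / k ⌉ for k ≥ 1 (k = 0 is never used; it gives -∞);  ⌈ -∞ / k ⌉ = -∞
ceilDiv∞ : ℤ∞ → ℕ → ℤ∞
ceilDiv∞ -∞      _       = -∞
ceilDiv∞ (fin a) zero    = -∞
ceilDiv∞ (fin a) (suc k) = fin (- ((- a) /ℕ suc k))

sumOver : ∀ {n} → Subset n → (Fin n → ℤ) → ℤ
sumOver {zero}  []            x = 0ℤ
sumOver {suc n} (inside ∷ Z)  x = x zero + sumOver Z (λ i → x (suc i))
sumOver {suc n} (outside ∷ Z) x = sumOver Z (λ i → x (suc i))

SetFn : ℕ → Set
SetFn n = Subset n → ℤ∞

Supermodular : ∀ {n} → SetFn n → Set
Supermodular {n} p = ∀ (X Y : Subset n) (a b : ℤ) → p X ≡ fin a → p Y ≡ fin b →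
  fin (a + b) ≤∞ p (X ∩ Y) +∞ p (X ∪ Y)

Admissible : ∀ {n} → SetFn n → Set
Admissible {n} p =
  (p Data.Fin.Subset.⊥ ≡ fin 0ℤ) × (∃[ c ] p Data.Fin.Subset.⊤ ≡ fin c) × Supermodular p

InB' : ∀ {n} → Subset n → SetFn n → (Fin n → ℤ) → Set
InB' {n} U q x = (q U ≡ fin (sumOver U x)) ×
  (∀ (Z : Subset n) → Z ⊆ U → q Z ≤∞ fin (sumOver Z x))

InT : ∀ {n} → Subset n → ℤ → (Fin n → ℤ) → Set
InT U β x = ∀ s → s ∈ U → (β - 1ℤ ≤ x s) × (x s ≤ β)

module ≥Sort = Sort (Flip.decTotalOrder ≤-decTotalOrder)

sortDesc : List ℤ → List ℤ
sortDesc = ≥Sort.sort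

length-sortDesc : ∀ {n} (x : Fin n → ℤ) →
  n ≡ length (sortDesc (toList (Data.Vec.tabulate x)))
length-sortDesc {n} x =
  sym (trans (↭-length (≥Sort.sort-↭ (toList (Data.Vec.tabulate x))))
             (length-toList (Data.Vec.tabulate x)))

_↓ : ∀ {n} → (Fin n → ℤ) → (Fin n → ℤ)
(x ↓) i = Data.List.lookup (sortDesc (toList (Data.Vec.tabulate x)))
                           (cast (length-sortDesc x) i)

DecLeq : ∀ {n} → (Fin n → ℤ) → (Fin n → ℤ) → Set
DecLeq {n} u v = (∀ i → u i ≡ v i) ⊎
  (∃[ j ] ((∀ (i : Fin n) → Data.Fin._<_ i j → u i ≡ v i) × (u j < v j)))

DecMinIn : ∀ {n} → ((Fin n → ℤ) → Set) → (Fin n → ℤ) → Set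
DecMinIn {n} P m = P m × (∀ (y : Fin n → ℤ) → P y → DecLeq (m ↓) (y ↓))

-- one step: given C = C_{j-1}, β = β_j and S' = S_j
module _ {n : ℕ} (p : SetFn n) (C : Subset n) where

  Δ : Subset n → ℤ∞
  Δ X = diff∞ (p (X ∪ C)) (p C)

  IsBeta : ℤ → Set
  IsBeta β =
    (∀ (X : Subset n) → Nonempty X → X ⊆ ∁ C → ceilDiv∞ (Δ X) ∣ X ∣ ≤∞ fin β) ×
    (∃[ X ] (Nonempty X × X ⊆ ∁ C × (ceilDiv∞ (Δ X) ∣ X ∣ ≡ fin β)))

  hFn : ℤ → Subset n → ℤ∞
  hFn β X = Δ X +∞ fin (- ((β - 1ℤ) * + ∣ X ∣))

  IsMaximizer : ℤ → Subset n → Set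
  IsMaximizer β X = X ⊆ ∁ C × (∀ (Y : Subset n) → Y ⊆ ∁ C → hFn β Y ≤∞ hFn β X)

  IsIntersectionOfMaximizers : ℤ → Subset n → Set
  IsIntersectionOfMaximizers β S' =
    ∀ (s : Fin n) → (s ∈ S') ⇔ (∀ (X : Subset n) → IsMaximizer β X → s ∈ X)

  CanonicalStep : ℤ → Subset n → Set
  CanonicalStep β S' = IsBeta β × IsIntersectionOfMaximizers β S'

-- (q, C, β, Sp) is the canonical chain / essential value-sequence / canonical
-- partition of p:  C 0 = ∅, C q = S, C j ≠ S for j < q, and for 1 ≤ j ≤ q
-- β j = β_j, Sp j = S_j, C j = C (j-1) ∪ Sp j.  (Values at other indices are
-- irrelevant.)
IsCanonical : ∀ {n} → SetFn n → (q : ℕ) → (ℕ → Subset n) → (ℕ → ℤ) →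
  (ℕ → Subset n) → Set
IsCanonical {n} p q C β Sp =
  (C 0 ≡ Data.Fin.Subset.⊥) × (C q ≡ Data.Fin.Subset.⊤) ×
  (∀ j → j ℕ.< q → (C j ≡ Data.Fin.Subset.⊤ → Data.Empty.⊥)) ×
  (∀ j → j ℕ.< q →
     CanonicalStep p (C j) (β (suc j)) (Sp (suc j)) × (C (suc j) ≡ C j ∪ Sp (suc j)))
  where import Data.Empty

pᵢ : ∀ {n} → SetFn n → Subset n → SetFn n
pᵢ p Cprev X = diff∞ (p (X ∪ Cprev)) (p Cprev)

-- Write excess t x = Σ_s max(x(s) − t, 0). If excess t x ≤ excess t y for
-- every threshold t then x↓ is decreasingly below y↓, and for every set X
-- excess t x ≥ x̃(X) − t|X|, with equality exactly when X separates the values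
-- ≥ t from the values ≤ t. Supermodularity makes C_j a maximizer of
-- p(X) − t|X| for β_{j+1} ≤ t ≤ β_j − 1.
--
-- If m|S_j ∈ B_j ∩ T_j for all j, the C_j are level sets of m with
-- m̃(C_j) = p(C_j), so excess t m = p(C_j) − t|C_j| ≤ ỹ(C_j) − t|C_j| ≤ excess t y
-- for every y ∈ B. Conversely, if m is decreasingly minimal, every pair
-- m(d) + 1 < m(s) is separated by a tight set (else moving a unit from s to d
-- would stay in B and lower the excess), so m has tight level sets at every
-- threshold; comparing them with the maximizers C_j and C_{j+1} at t = β_{j+1}
-- and t = β_{j+1} − 1 forces those to be tight level sets, which is
-- m|S_{j+1} ∈ B_{j+1} ∩ T_{j+1}.

module Submission where

open import Defs
open import Data.Empty using (⊥-elim)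
open import Data.Fin.Base as Fin using (Fin; zero; suc; toℕ; cast)
open import Data.Fin.Properties using (toℕ-cast; toℕ-injective; any?)
open import Data.Fin.Subset
  using (Subset; inside; outside; _∈_; _∉_; _∪_; _∩_; ∁; ∣_∣; _⊆_; Nonempty; ⊤)
  renaming (⊥ to ∅)
open import Data.Fin.Subset.Properties
  using ( _∈?_; _⊆?_; ∈⊤; ⊆⊤; ∉⊥; ∣⊥∣≡0; ⊆-antisym; Empty-unique; nonempty?; anySubset?
        ; x∈p∩q⁺; x∈p∩q⁻; x∈p∪q⁺; x∈p∪q⁻; p∩q⊆p; p∩q⊆q; x∈∁p⇒x∉p; x∉p⇒x∈∁p
        ; p⊆q⇒∣p∣≤∣q∣; ∩-identityˡ; ∪-comm; ∪-identityˡ; ∪-assoc; ∪-distribʳ-∩; ∪-idem )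
open import Data.Integer.Base
  using (ℤ; +_; _+_; _-_; -_; _*_; _⊔_; _≤_; _<_; 0ℤ; 1ℤ; +≤+; -<+; _/ℕ_)
open import Data.Integer.Properties
open import Data.Integer.DivMod using ([n/ℕd]*d≤n; n<s[n/ℕd]*d)
open import Data.Integer.Tactic.RingSolver using (solve-∀)
open import Data.Nat.Base as ℕ using (ℕ; zero; suc)
import Data.Nat.Properties as ℕ
open import Data.List.Base using (List; foldr; map; lookup; length)
open import Data.List.Relation.Binary.Permutation.Propositional using (↭⇒↭ₛ)
import Data.List.Relation.Binary.Permutation.Propositional.Properties as ↭
import Data.List.Relation.Binary.Permutation.Setoid.Properties as ↭ₛ
open import Data.List.Relation.Unary.Sorted.TotalOrder.Properties using (lookup-mono-≤)
open import Data.Product using (∃-syntax; _×_; _,_; proj₁; proj₂)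
open import Data.Sum using (_⊎_; inj₁; inj₂)
open import Data.Vec using ([]; _∷_; here; there; toList; tabulate)
open import Function.Base using (id; _∘_; _∘₂_)
open import Function.Bundles using (_⇔_; mk⇔; Equivalence)
open import Relation.Binary.Bundles using (DecTotalOrder)
import Relation.Binary.Construct.Flip.EqAndOrd as Flip
open import Relation.Binary.Definitions using (tri<; tri≈; tri>)
open import Relation.Binary.PropositionalEquality
open import Relation.Nullary using (¬_; Dec; yes; no)
open import Relation.Nullary.Decidable using (¬?; _×-dec_)

private
  variable
    n : ℕ

fin-injective : ∀ {a b} → fin a ≡ fin b → a ≡ b
fin-injective refl = refl

fin-≤∞⁻ : ∀ {a b} → fin a ≤∞ fin b → a ≤ b
fin-≤∞⁻ (fin≤ a≤b) = a≤b

≤∞-refl : ∀ {e} → e ≤∞ e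
≤∞-refl { -∞}   = -∞≤
≤∞-refl {fin a} = fin≤ ≤-refl

≤∞-trans : ∀ {e f g} → e ≤∞ f → f ≤∞ g → e ≤∞ g
≤∞-trans -∞≤      _        = -∞≤
≤∞-trans (fin≤ p) (fin≤ q) = fin≤ (≤-trans p q)

≤∞-total : ∀ e f → e ≤∞ f ⊎ f ≤∞ e
≤∞-total -∞      _       = inj₁ -∞≤
≤∞-total (fin a) -∞      = inj₂ -∞≤
≤∞-total (fin a) (fin b) with ≤-total a b
... | inj₁ a≤b = inj₁ (fin≤ a≤b)
... | inj₂ b≤a = inj₂ (fin≤ b≤a)

_≤∞?_ : ∀ e f → Dec (e ≤∞ f)
-∞    ≤∞? _     = yes -∞≤
fin a ≤∞? -∞    = no λ ()
fin a ≤∞? fin b with a ≤? b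
... | yes a≤b = yes (fin≤ a≤b)
... | no  a≰b = no λ { (fin≤ a≤b) → a≰b a≤b }

_≟∞_ : ∀ (e f : ℤ∞) → Dec (e ≡ f)
-∞    ≟∞ -∞    = yes refl
-∞    ≟∞ fin _ = no λ ()
fin _ ≟∞ -∞    = no λ ()
fin a ≟∞ fin b with a ≟ b
... | yes refl = yes refl
... | no  a≢b  = no (a≢b ∘ fin-injective)

≤∞-finite⁻ : ∀ {z e} → fin z ≤∞ e → ∃[ x ] e ≡ fin x
≤∞-finite⁻ (fin≤ {b = x} _) = x , refl

≤∞-+∞-finite : ∀ {c} e f → fin c ≤∞ e +∞ f →
  ∃[ a ] ∃[ b ] e ≡ fin a × f ≡ fin b × c ≤ a + b
≤∞-+∞-finite (fin a) (fin b) (fin≤ c≤a+b) = a , b , refl , refl , c≤a+b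

-- Since ℤ has no linear-arithmetic decision procedure, inequalities are
-- combined by exhibiting the gap as a sum of known non-negative terms,
-- with the identity certified by the ring solver.
≤-by-gap : ∀ {x y g} → 0ℤ ≤ g → y - x ≡ g → x ≤ y
≤-by-gap 0≤g refl = 0≤i-j⇒j≤i 0≤g

0≤* : ∀ {a b} → 0ℤ ≤ a → 0ℤ ≤ b → 0ℤ ≤ a * b
0≤* {+ a} {+ b} _ _ = subst (0ℤ ≤_) (pos-* a b) (+≤+ ℕ.z≤n)

+-cancelʳ-≤ : ∀ {a b} c → a + c ≤ b + c → a ≤ b
+-cancelʳ-≤ {a} {b} c a+c≤b+c =
  subst₂ _≤_ (cancel a c) (cancel b c) (+-monoˡ-≤ (- c) a+c≤b+c)
  where
  cancel : ∀ a c → a + c - c ≡ a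
  cancel = solve-∀

+-cancelˡ-≤ : ∀ {a b} c → c + a ≤ c + b → a ≤ b
+-cancelˡ-≤ {a} {b} c = +-cancelʳ-≤ c ∘ subst₂ _≤_ (+-comm c a) (+-comm c b)

<⇒≤-1 : ∀ {a b} → a < b → a ≤ b - 1ℤ
<⇒≤-1 {a} a<b = subst (_≤ _) (lemma a) (+-monoˡ-≤ (- 1ℤ) (i<j⇒suc[i]≤j a<b))
  where
  lemma : ∀ a → 1ℤ + a - 1ℤ ≡ a
  lemma = solve-∀

≤-+-nonneg : ∀ a {b} → 0ℤ ≤ b → a ≤ a + b
≤-+-nonneg a 0≤b = subst (_≤ a + _) (+-identityʳ a) (+-monoʳ-≤ a 0≤b)

i-1≤i : ∀ i → i - 1ℤ ≤ i
i-1≤i i = i≤j⇒i-k≤j 1ℤ ≤-refl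

/ℕ-galois : ∀ e d q → q ≤ e /ℕ suc d ⇔ q * + suc d ≤ e
/ℕ-galois e d q = mk⇔
  (λ q≤e/d → ≤-trans (*-monoʳ-≤-nonNeg (+ suc d) q≤e/d) ([n/ℕd]*d≤n e (suc d)))
  (λ qd≤e → subst (q ≤_) (lemma (e /ℕ suc d)) (<⇒≤-1 (q<1+e/d qd≤e)))
  where
  q<1+e/d : q * + suc d ≤ e → q < 1ℤ + e /ℕ suc d
  q<1+e/d qd≤e = *-cancelʳ-<-nonNeg (+ suc d) (≤-<-trans qd≤e (n<s[n/ℕd]*d e (suc d)))
  lemma : ∀ a → 1ℤ + a - 1ℤ ≡ a
  lemma = solve-∀

ceilDiv∞-≤ : ∀ a k b → ceilDiv∞ (fin a) (suc k) ≤∞ fin b ⇔ a ≤ b * + suc k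
ceilDiv∞-≤ a k b = mk⇔
  (λ { (fin≤ ⌈a/d⌉≤b) → subst₂ _≤_ (neg-involutive a) (flip b (+ suc k))
         (neg-mono-≤ (Equivalence.to (/ℕ-galois (- a) k (- b))
           (subst (- b ≤_) (neg-involutive _) (neg-mono-≤ ⌈a/d⌉≤b)))) })
  (λ a≤bd → fin≤ (subst (_ ≤_) (neg-involutive b)
     (neg-mono-≤ (Equivalence.from (/ℕ-galois (- a) k (- b))
       (subst (_≤ - a) (neg-distribˡ-* b (+ suc k)) (neg-mono-≤ a≤bd))))))
  where
  flip : ∀ b d → - (- b * d) ≡ b * d
  flip = solve-∀

-- Sums over subsets

card : ∀ {n} → Subset n → ℤ
card X = + ∣ X ∣

sumOver-∅ : ∀ {n} (f : Fin n → ℤ) → sumOver ∅ f ≡ 0ℤ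
sumOver-∅ {zero}  f = refl
sumOver-∅ {suc n} f = sumOver-∅ (f ∘ suc)

card-∅ : ∀ n → card (∅ {n}) ≡ 0ℤ
card-∅ n = cong +_ (∣⊥∣≡0 n)

sumOver-cong : ∀ (Z : Subset n) {f g} → (∀ s → s ∈ Z → f s ≡ g s) →
  sumOver Z f ≡ sumOver Z g
sumOver-cong []            f≡g = refl
sumOver-cong (inside ∷ Z)  f≡g =
  cong₂ _+_ (f≡g zero here) (sumOver-cong Z (λ s → f≡g (suc s) ∘ there))
sumOver-cong (outside ∷ Z) f≡g = sumOver-cong Z (λ s → f≡g (suc s) ∘ there)

sumOver-mono : ∀ (Z : Subset n) {f g} → (∀ s → s ∈ Z → f s ≤ g s) →
  sumOver Z f ≤ sumOver Z g
sumOver-mono []            f≤g = ≤-refl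
sumOver-mono (inside ∷ Z)  f≤g =
  +-mono-≤ (f≤g zero here) (sumOver-mono Z (λ s → f≤g (suc s) ∘ there))
sumOver-mono (outside ∷ Z) f≤g = sumOver-mono Z (λ s → f≤g (suc s) ∘ there)

sumOver-+ : ∀ (Z : Subset n) f g →
  sumOver Z (λ s → f s + g s) ≡ sumOver Z f + sumOver Z g
sumOver-+ []            f g = refl
sumOver-+ (inside ∷ Z)  f g =
  trans (cong (_+_ (f zero + g zero)) (sumOver-+ Z (f ∘ suc) (g ∘ suc)))
        (+-interchange (f zero) (g zero) _ _)
  where
  +-interchange : ∀ a b c d → (a + b) + (c + d) ≡ (a + c) + (b + d)
  +-interchange = solve-∀
sumOver-+ (outside ∷ Z) f g = sumOver-+ Z (f ∘ suc) (g ∘ suc)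

sumOver-const : ∀ (Z : Subset n) c → sumOver Z (λ _ → c) ≡ c * card Z
sumOver-const []            c = sym (*-zeroʳ c)
sumOver-const (inside ∷ Z)  c =
  trans (cong (_+_ c) (sumOver-const Z c)) (lemma c (card Z))
  where
  lemma : ∀ c k → c + c * k ≡ c * (1ℤ + k)
  lemma = solve-∀
sumOver-const (outside ∷ Z) c = sumOver-const Z c

sumOver-zero : ∀ (Z : Subset n) → sumOver Z (λ _ → 0ℤ) ≡ 0ℤ
sumOver-zero Z = trans (sumOver-const Z 0ℤ) (*-zeroˡ (card Z))

sumOver-nonneg : ∀ (Z : Subset n) {f} → (∀ s → s ∈ Z → 0ℤ ≤ f s) →
  0ℤ ≤ sumOver Z f
sumOver-nonneg Z {f} 0≤f = subst (_≤ sumOver Z f) (sumOver-zero Z) (sumOver-mono Z 0≤f)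

sumOver-nonpos : ∀ (Z : Subset n) {f} → (∀ s → s ∈ Z → f s ≤ 0ℤ) →
  sumOver Z f ≤ 0ℤ
sumOver-nonpos Z {f} f≤0 = subst (sumOver Z f ≤_) (sumOver-zero Z) (sumOver-mono Z f≤0)

sumOver-shift : ∀ (Z : Subset n) f t →
  sumOver Z (λ s → f s - t) ≡ sumOver Z f - t * card Z
sumOver-shift Z f t =
  trans (sumOver-+ Z f (λ _ → - t))
        (cong (_+_ (sumOver Z f)) (trans (sumOver-const Z (- t)) (sym (neg-distribˡ-* t (card Z)))))

sumOver-mono-tight : ∀ (Z : Subset n) {f g} → (∀ s → s ∈ Z → f s ≤ g s) →
  sumOver Z g ≤ sumOver Z f → ∀ s → s ∈ Z → g s ≤ f s
sumOver-mono-tight (inside ∷ Z) {f} {g} f≤g Σg≤Σf zero here =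
  +-cancelʳ-≤ _ (≤-trans Σg≤Σf (+-monoʳ-≤ (f zero) (sumOver-mono Z (λ s → f≤g (suc s) ∘ there))))
sumOver-mono-tight (inside ∷ Z) {f} {g} f≤g Σg≤Σf (suc s) (there s∈Z) =
  sumOver-mono-tight Z (λ s → f≤g (suc s) ∘ there)
    (+-cancelˡ-≤ (g zero) (≤-trans Σg≤Σf (+-monoˡ-≤ _ (f≤g zero here)))) s s∈Z
sumOver-mono-tight (outside ∷ Z) f≤g Σg≤Σf (suc s) (there s∈Z) =
  sumOver-mono-tight Z (λ s → f≤g (suc s) ∘ there) Σg≤Σf s s∈Z

sumOver-∪+∩ : ∀ (X Y : Subset n) f →
  sumOver (X ∪ Y) f + sumOver (X ∩ Y) f ≡ sumOver X f + sumOver Y f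
sumOver-∪+∩ []            []            f = refl
sumOver-∪+∩ (inside ∷ X)  (inside ∷ Y)  f =
  both (f zero) _ _ (sumOver X (f ∘ suc)) _ (sumOver-∪+∩ X Y (f ∘ suc))
  where
  both : ∀ a u i x y → u + i ≡ x + y → (a + u) + (a + i) ≡ (a + x) + (a + y)
  both a u i x y e = trans (regroup a u i) (trans (cong (_+_ (a + a)) e) (sym (regroup a x y)))
    where
    regroup : ∀ a u i → (a + u) + (a + i) ≡ (a + a) + (u + i)
    regroup = solve-∀
sumOver-∪+∩ (inside ∷ X)  (outside ∷ Y) f =
  left (f zero) _ _ (sumOver X (f ∘ suc)) _ (sumOver-∪+∩ X Y (f ∘ suc))
  where
  left : ∀ a u i x y → u + i ≡ x + y → (a + u) + i ≡ (a + x) + y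
  left a u i x y e = trans (+-assoc a u i) (trans (cong (_+_ a) e) (sym (+-assoc a x y)))
sumOver-∪+∩ (outside ∷ X) (inside ∷ Y)  f =
  right (f zero) _ _ (sumOver X (f ∘ suc)) _ (sumOver-∪+∩ X Y (f ∘ suc))
  where
  right : ∀ a u i x y → u + i ≡ x + y → (a + u) + i ≡ x + (a + y)
  right a u i x y e = trans (+-assoc a u i) (trans (cong (_+_ a) e) (swap a x y))
    where
    swap : ∀ a x y → a + (x + y) ≡ x + (a + y)
    swap = solve-∀
sumOver-∪+∩ (outside ∷ X) (outside ∷ Y) f = sumOver-∪+∩ X Y (f ∘ suc)

sumOver-split : ∀ (Y C : Subset n) f →
  sumOver Y f ≡ sumOver (Y ∩ C) f + sumOver (Y ∩ ∁ C) f
sumOver-split []            []            f = refl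
sumOver-split (inside ∷ Y)  (inside ∷ C)  f =
  trans (cong (_+_ (f zero)) (sumOver-split Y C (f ∘ suc))) (sym (+-assoc (f zero) _ _))
sumOver-split (inside ∷ Y)  (outside ∷ C) f =
  trans (cong (_+_ (f zero)) (sumOver-split Y C (f ∘ suc))) (swap (f zero) (sumOver (Y ∩ C) (f ∘ suc)) _)
  where
  swap : ∀ a b c → a + (b + c) ≡ b + (a + c)
  swap = solve-∀
sumOver-split (outside ∷ Y) (_ ∷ C)       f = sumOver-split Y C (f ∘ suc)

sumOver-disjoint-∪ : ∀ (X Y : Subset n) f → X ⊆ ∁ Y →
  sumOver (X ∪ Y) f ≡ sumOver X f + sumOver Y f
sumOver-disjoint-∪ X Y f X⊆∁Y = begin
  sumOver (X ∪ Y) f                        ≡⟨ +-identityʳ _ ⟨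
  sumOver (X ∪ Y) f + 0ℤ                   ≡⟨ cong (_+_ (sumOver (X ∪ Y) f)) (sumOver-∅ f) ⟨
  sumOver (X ∪ Y) f + sumOver ∅ f          ≡⟨ cong (λ Z → sumOver (X ∪ Y) f + sumOver Z f) X∩Y≡∅ ⟨
  sumOver (X ∪ Y) f + sumOver (X ∩ Y) f    ≡⟨ sumOver-∪+∩ X Y f ⟩
  sumOver X f + sumOver Y f                ∎
  where
  open ≡-Reasoning
  X∩Y≡∅ : X ∩ Y ≡ ∅
  X∩Y≡∅ = Empty-unique λ (s , s∈X∩Y) →
    let s∈X , s∈Y = x∈p∩q⁻ X Y s∈X∩Y in x∈∁p⇒x∉p (X⊆∁Y s∈X) s∈Y

sumOver-⊤-split : ∀ (X : Subset n) f → sumOver ⊤ f ≡ sumOver X f + sumOver (∁ X) f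
sumOver-⊤-split X f =
  trans (sumOver-split ⊤ X f) (cong₂ (λ A B → sumOver A f + sumOver B f) (∩-identityˡ X) (∩-identityˡ (∁ X)))

sumOver-one : ∀ (Z : Subset n) → sumOver Z (λ _ → 1ℤ) ≡ card Z
sumOver-one Z = trans (sumOver-const Z 1ℤ) (*-identityˡ (card Z))

card-∪+∩ : ∀ (X Y : Subset n) → card (X ∪ Y) + card (X ∩ Y) ≡ card X + card Y
card-∪+∩ X Y = subst₂ _≡_ (cong₂ _+_ (sumOver-one (X ∪ Y)) (sumOver-one (X ∩ Y)))
                          (cong₂ _+_ (sumOver-one X) (sumOver-one Y)) (sumOver-∪+∩ X Y (λ _ → 1ℤ))

card-split : ∀ (Y C : Subset n) → card Y ≡ card (Y ∩ C) + card (Y ∩ ∁ C)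
card-split Y C = subst₂ _≡_ (sumOver-one Y) (cong₂ _+_ (sumOver-one (Y ∩ C)) (sumOver-one (Y ∩ ∁ C)))
                            (sumOver-split Y C (λ _ → 1ℤ))

card-disjoint-∪ : ∀ (X Y : Subset n) → X ⊆ ∁ Y → card (X ∪ Y) ≡ card X + card Y
card-disjoint-∪ X Y X⊆∁Y = subst₂ _≡_ (sumOver-one (X ∪ Y)) (cong₂ _+_ (sumOver-one X) (sumOver-one Y))
                                      (sumOver-disjoint-∪ X Y (λ _ → 1ℤ) X⊆∁Y)

card-mono : ∀ {X Y : Subset n} → X ⊆ Y → card X ≤ card Y
card-mono X⊆Y = +≤+ (p⊆q⇒∣p∣≤∣q∣ X⊆Y)

⊆⇒∩≡ : ∀ {X Y : Subset n} → X ⊆ Y → X ∩ Y ≡ X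
⊆⇒∩≡ {X = X} {Y} X⊆Y = ⊆-antisym (p∩q⊆p X Y) (λ s∈X → x∈p∩q⁺ (s∈X , X⊆Y s∈X))

nonempty⇒∣∣≡suc : ∀ {X : Subset n} → Nonempty X → ∃[ k ] ∣ X ∣ ≡ suc k
nonempty⇒∣∣≡suc {X = inside  ∷ X} _                  = ∣ X ∣ , refl
nonempty⇒∣∣≡suc {X = outside ∷ X} (suc s , there s∈X) = nonempty⇒∣∣≡suc (s , s∈X)

∩∁-∪ : ∀ (Y C : Subset n) → (Y ∩ ∁ C) ∪ C ≡ Y ∪ C
∩∁-∪ Y C = ⊆-antisym into onto
  where
  into : (Y ∩ ∁ C) ∪ C ⊆ Y ∪ C
  into s∈ with x∈p∪q⁻ (Y ∩ ∁ C) C s∈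
  ... | inj₁ s∈Y∩∁C = x∈p∪q⁺ (inj₁ (proj₁ (x∈p∩q⁻ Y (∁ C) s∈Y∩∁C)))
  ... | inj₂ s∈C    = x∈p∪q⁺ (inj₂ s∈C)
  onto : Y ∪ C ⊆ (Y ∩ ∁ C) ∪ C
  onto {s} s∈ with x∈p∪q⁻ Y C s∈ | s ∈? C
  ... | _         | yes s∈C = x∈p∪q⁺ (inj₂ s∈C)
  ... | inj₁ s∈Y  | no  s∉C = x∈p∪q⁺ (inj₁ (x∈p∩q⁺ (s∈Y , x∉p⇒x∈∁p s∉C)))
  ... | inj₂ s∈C  | no  s∉C = ⊥-elim (s∉C s∈C)

∪-distribʳ-∪ : ∀ (X Y C : Subset n) → (X ∪ C) ∪ (Y ∪ C) ≡ (X ∪ Y) ∪ C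
∪-distribʳ-∪ X Y C = begin
  (X ∪ C) ∪ (Y ∪ C)  ≡⟨ ∪-assoc X C (Y ∪ C) ⟩
  X ∪ (C ∪ (Y ∪ C))  ≡⟨ cong (X ∪_) (∪-comm C (Y ∪ C)) ⟩
  X ∪ ((Y ∪ C) ∪ C)  ≡⟨ cong (X ∪_) (∪-assoc Y C C) ⟩
  X ∪ (Y ∪ (C ∪ C))  ≡⟨ cong (λ Z → X ∪ (Y ∪ Z)) (∪-idem C) ⟩
  X ∪ (Y ∪ C)        ≡⟨ ∪-assoc X Y C ⟨
  (X ∪ Y) ∪ C        ∎
  where open ≡-Reasoning

infixl 7 _∩⋂_
infixl 6 _∪⋃_

_∩⋂_ : ∀ {k} → Subset n → (Fin k → Subset n) → Subset n
_∩⋂_ {k = zero}  A F = A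
_∩⋂_ {k = suc k} A F = (A ∩ F zero) ∩⋂ (F ∘ suc)

_∪⋃_ : ∀ {k} → Subset n → (Fin k → Subset n) → Subset n
_∪⋃_ {k = zero}  A F = A
_∪⋃_ {k = suc k} A F = (A ∪ F zero) ∪⋃ (F ∘ suc)

module _ {ℓ} (P : Subset n → Set ℓ) where

  ∩⋂-closed : (∀ {X Y} → P X → P Y → P (X ∩ Y)) →
    ∀ {k A} {F : Fin k → Subset n} → P A → (∀ i → P (F i)) → P (A ∩⋂ F)
  ∩⋂-closed ∩-closed {zero}  PA PF = PA
  ∩⋂-closed ∩-closed {suc k} PA PF = ∩⋂-closed ∩-closed (∩-closed PA (PF zero)) (PF ∘ suc)

  ∪⋃-closed : (∀ {X Y} → P X → P Y → P (X ∪ Y)) →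
    ∀ {k A} {F : Fin k → Subset n} → P A → (∀ i → P (F i)) → P (A ∪⋃ F)
  ∪⋃-closed ∪-closed {zero}  PA PF = PA
  ∪⋃-closed ∪-closed {suc k} PA PF = ∪⋃-closed ∪-closed (∪-closed PA (PF zero)) (PF ∘ suc)

∈-∩⋂⁺ : ∀ {k} {s : Fin n} {A} {F : Fin k → Subset n} → s ∈ A → (∀ i → s ∈ F i) → s ∈ A ∩⋂ F
∈-∩⋂⁺ {k = zero}  s∈A s∈F = s∈A
∈-∩⋂⁺ {k = suc k} s∈A s∈F = ∈-∩⋂⁺ (x∈p∩q⁺ (s∈A , s∈F zero)) (s∈F ∘ suc)

∈-∩⋂⁻ : ∀ {k} {s : Fin n} A (F : Fin k → Subset n) → s ∈ A ∩⋂ F → s ∈ A × (∀ i → s ∈ F i)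
∈-∩⋂⁻ {k = zero}  A F s∈ = s∈ , λ ()
∈-∩⋂⁻ {k = suc k} A F s∈ with ∈-∩⋂⁻ (A ∩ F zero) (F ∘ suc) s∈
... | s∈A∩F₀ , s∈F' = let s∈A , s∈F₀ = x∈p∩q⁻ A (F zero) s∈A∩F₀ in
  s∈A , λ { zero → s∈F₀ ; (suc i) → s∈F' i }

∈-∪⋃⁺ : ∀ {k} {s : Fin n} {A} {F : Fin k → Subset n} → s ∈ A ⊎ (∃[ i ] s ∈ F i) → s ∈ A ∪⋃ F
∈-∪⋃⁺ {k = zero}  (inj₁ s∈A)         = s∈A
∈-∪⋃⁺ {k = suc k} {A = A} {F} (inj₁ s∈A) =
  ∈-∪⋃⁺ {A = A ∪ F zero} {F ∘ suc} (inj₁ (x∈p∪q⁺ (inj₁ s∈A)))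
∈-∪⋃⁺ {k = suc k} {A = A} {F} (inj₂ (zero  , s∈)) =
  ∈-∪⋃⁺ {A = A ∪ F zero} {F ∘ suc} (inj₁ (x∈p∪q⁺ (inj₂ s∈)))
∈-∪⋃⁺ {k = suc k} {A = A} {F} (inj₂ (suc i , s∈)) =
  ∈-∪⋃⁺ {A = A ∪ F zero} {F ∘ suc} (inj₂ (i , s∈))

∈-∪⋃⁻ : ∀ {k} {s : Fin n} A (F : Fin k → Subset n) → s ∈ A ∪⋃ F → s ∈ A ⊎ (∃[ i ] s ∈ F i)
∈-∪⋃⁻ {k = zero}  A F s∈ = inj₁ s∈
∈-∪⋃⁻ {k = suc k} A F s∈ with ∈-∪⋃⁻ (A ∪ F zero) (F ∘ suc) s∈
... | inj₂ (i , s∈Fi) = inj₂ (suc i , s∈Fi)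
... | inj₁ s∈A∪F₀ with x∈p∪q⁻ A (F zero) s∈A∪F₀
...   | inj₁ s∈A  = inj₁ s∈A
...   | inj₂ s∈F₀ = inj₂ (zero , s∈F₀)

-- Maximizers of set functions

IsMaxOn : SetFn n → Subset n → Subset n → Set
IsMaxOn f D X = X ⊆ D × (∀ Y → Y ⊆ D → f Y ≤∞ f X)

maximum-exists : ∀ (f : SetFn n) → ∃[ X ] ∀ Y → f Y ≤∞ f X
maximum-exists {n = zero}  f = [] , λ { [] → ≤∞-refl }
maximum-exists {n = suc n} f
  with maximum-exists (f ∘ (inside ∷_)) | maximum-exists (f ∘ (outside ∷_))
... | X , X-max | X' , X'-max with ≤∞-total (f (inside ∷ X)) (f (outside ∷ X'))
...   | inj₁ f[X]≤f[X'] = outside ∷ X' , λ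
  { (inside ∷ Y) → ≤∞-trans (X-max Y) f[X]≤f[X'] ; (outside ∷ Y) → X'-max Y }
...   | inj₂ f[X']≤f[X] = inside ∷ X , λ
  { (inside ∷ Y) → X-max Y ; (outside ∷ Y) → ≤∞-trans (X'-max Y) f[X']≤f[X] }

maximizer-exists : ∀ (f : SetFn n) D → ∃[ X ] IsMaxOn f D X
maximizer-exists f D with maximum-exists (λ Y → f (Y ∩ D))
... | X , X-max = X ∩ D , p∩q⊆q X D , λ Y Y⊆D → subst (λ Z → f Z ≤∞ f (X ∩ D)) (⊆⇒∩≡ Y⊆D) (X-max Y)

maximizers-∩-closed : ∀ {f : SetFn n} {D X Y} → Supermodular f →
  IsMaxOn f D X → IsMaxOn f D Y → IsMaxOn f D (X ∩ Y)
maximizers-∩-closed {f = f} {D} {X} {Y} sup (X⊆D , X-max) (Y⊆D , Y-max) =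
  (λ s∈ → X⊆D (p∩q⊆p X Y s∈)) , bound (f X) (f Y) refl refl (Y-max X X⊆D)
  where
  X∪Y⊆D : X ∪ Y ⊆ D
  X∪Y⊆D s∈ with x∈p∪q⁻ X Y s∈
  ... | inj₁ s∈X = X⊆D s∈X
  ... | inj₂ s∈Y = Y⊆D s∈Y
  bound : ∀ e e′ → f X ≡ e → f Y ≡ e′ → e ≤∞ e′ → ∀ Z → Z ⊆ D → f Z ≤∞ f (X ∩ Y)
  bound -∞ _ f[X]≡-∞ _ _ Z Z⊆D with f Z | subst (f Z ≤∞_) f[X]≡-∞ (X-max Z Z⊆D)
  ... | -∞ | _ = -∞≤
  bound (fin a) (fin b) f[X]≡a f[Y]≡b _ Z Z⊆D
    with ≤∞-+∞-finite (f (X ∩ Y)) (f (X ∪ Y)) (sup X Y a b f[X]≡a f[Y]≡b)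
  ... | u , v , f[X∩Y]≡u , f[X∪Y]≡v , a+b≤u+v =
    subst (f Z ≤∞_) (sym f[X∩Y]≡u) (≤∞-trans (subst (f Z ≤∞_) f[Y]≡b (Y-max Z Z⊆D)) (fin≤ b≤u))
    where
    v≤a : v ≤ a
    v≤a = fin-≤∞⁻ (subst₂ _≤∞_ f[X∪Y]≡v f[X]≡a (X-max (X ∪ Y) X∪Y⊆D))
    b≤u : b ≤ u
    b≤u = +-cancelˡ-≤ a (≤-trans a+b≤u+v (subst (u + v ≤_) (+-comm u a) (+-monoʳ-≤ u v≤a)))

-- M is cut out of one maximizer by the finitely many maximizers avoiding
-- the points outside M.
⋂maximizers-isMax : ∀ {f : SetFn n} {D M} → Supermodular f →
  (∀ s → s ∈ M ⇔ (∀ X → IsMaxOn f D X → s ∈ X)) → IsMaxOn f D M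
⋂maximizers-isMax {n = n} {f = f} {D} {M} sup M≡⋂ = subst (IsMaxOn f D) (sym M≡N) N-max
  where
  M₀ : Subset n
  M₀ = proj₁ (maximizer-exists f D)
  M₀-max : IsMaxOn f D M₀
  M₀-max = proj₂ (maximizer-exists f D)

  avoiding : ∀ s → ∃[ X ] IsMaxOn f D X × (s ∈ M ⊎ s ∉ X)
  avoiding s with s ∈? M
  ... | yes s∈M = M₀ , M₀-max , inj₁ s∈M
  ... | no  s∉M with anySubset? (λ X → ((X ⊆? D) ×-dec (f M₀ ≤∞? f X)) ×-dec ¬? (s ∈? X))
  ...   | yes (X , (X⊆D , f[M₀]≤f[X]) , s∉X) =
    X , (X⊆D , λ Y Y⊆D → ≤∞-trans (proj₂ M₀-max Y Y⊆D) f[M₀]≤f[X]) , inj₂ s∉X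
  ...   | no ∄X = ⊥-elim (s∉M (Equivalence.from (M≡⋂ s) in-every))
    where
    in-every : ∀ X → IsMaxOn f D X → s ∈ X
    in-every X (X⊆D , X-max) with s ∈? X
    ... | yes s∈X = s∈X
    ... | no  s∉X = ⊥-elim (∄X (X , (X⊆D , X-max M₀ (proj₁ M₀-max)) , s∉X))

  F : Fin n → Subset n
  F s = proj₁ (avoiding s)

  N : Subset n
  N = M₀ ∩⋂ F

  N-max : IsMaxOn f D N
  N-max = ∩⋂-closed (IsMaxOn f D) (maximizers-∩-closed sup) M₀-max (proj₁ ∘ proj₂ ∘ avoiding)

  N⊆M : N ⊆ M
  N⊆M {s} s∈N with proj₂ (proj₂ (avoiding s))
  ... | inj₁ s∈M = s∈M
  ... | inj₂ s∉F = ⊥-elim (s∉F (proj₂ (∈-∩⋂⁻ M₀ F s∈N) s))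

  M≡N : M ≡ N
  M≡N = ⊆-antisym (λ {s} s∈M → Equivalence.to (M≡⋂ s) s∈M N N-max) N⊆M

-- Excess and the decreasing order

_⁺ : ℤ → ℤ
x ⁺ = x ⊔ 0ℤ

⁺-nonneg : ∀ x → 0ℤ ≤ x ⁺
⁺-nonneg x = i≤j⊔i x 0ℤ

≤⁺ : ∀ x → x ≤ x ⁺
≤⁺ x = i≤i⊔j x 0ℤ

⁺-nonneg-id : ∀ {x} → 0ℤ ≤ x → x ⁺ ≡ x
⁺-nonneg-id = i≥j⇒i⊔j≡i

⁺-nonpos-0 : ∀ {x} → x ≤ 0ℤ → x ⁺ ≡ 0ℤ
⁺-nonpos-0 = i≤j⇒i⊔j≡j

excess : ℤ → (Fin n → ℤ) → ℤ
excess t x = sumOver ⊤ (λ s → (x s - t) ⁺)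

IsLevelSet : ℤ → (Fin n → ℤ) → Subset n → Set
IsLevelSet t x X = (∀ s → s ∈ X → t ≤ x s) × (∀ s → s ∉ X → x s ≤ t)

module _ (t : ℤ) (x : Fin n → ℤ) (X : Subset n) where

  private
    g : Fin n → ℤ
    g s = (x s - t) ⁺

  excess-≥ : sumOver X x - t * card X ≤ excess t x
  excess-≥ = begin
    sumOver X x - t * card X        ≡⟨ sumOver-shift X x t ⟨
    sumOver X (λ s → x s - t)       ≤⟨ sumOver-mono X (λ s _ → ≤⁺ (x s - t)) ⟩
    sumOver X g                     ≡⟨ +-identityʳ _ ⟨
    sumOver X g + 0ℤ                ≤⟨ +-monoʳ-≤ (sumOver X g) (sumOver-nonneg (∁ X) (λ s _ → ⁺-nonneg (x s - t))) ⟩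
    sumOver X g + sumOver (∁ X) g   ≡⟨ sumOver-⊤-split X g ⟨
    excess t x                      ∎
    where open ≤-Reasoning

  excess-levelSet : IsLevelSet t x X → excess t x ≡ sumOver X x - t * card X
  excess-levelSet (above , below) = begin
    excess t x                                   ≡⟨ sumOver-⊤-split X g ⟩
    sumOver X g + sumOver (∁ X) g                ≡⟨ cong₂ _+_ on-X off-X ⟩
    sumOver X (λ s → x s - t) + 0ℤ               ≡⟨ +-identityʳ _ ⟩
    sumOver X (λ s → x s - t)                    ≡⟨ sumOver-shift X x t ⟩
    sumOver X x - t * card X                     ∎
    where
    open ≡-Reasoning
    on-X : sumOver X g ≡ sumOver X (λ s → x s - t)
    on-X = sumOver-cong X (λ s s∈X → ⁺-nonneg-id (i≤j⇒0≤j-i (above s s∈X)))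
    off-X : sumOver (∁ X) g ≡ 0ℤ
    off-X = trans (sumOver-cong (∁ X) (λ s s∈∁X → ⁺-nonpos-0 (i≤j⇒i-j≤0 (below s (x∈∁p⇒x∉p s∈∁X)))))
                  (sumOver-zero (∁ X))

  excess-≤⇒levelSet : excess t x ≤ sumOver X x - t * card X → IsLevelSet t x X
  excess-≤⇒levelSet excess≤ = above , below
    where
    A B : ℤ
    A = sumOver X g
    B = sumOver (∁ X) g
    A+B≤E : A + B ≤ sumOver X (λ s → x s - t)
    A+B≤E = subst₂ _≤_ (sumOver-⊤-split X g) (sym (sumOver-shift X x t)) excess≤
    E≤A : sumOver X (λ s → x s - t) ≤ A
    E≤A = sumOver-mono X (λ s _ → ≤⁺ (x s - t))
    0≤B : 0ℤ ≤ B
    0≤B = sumOver-nonneg (∁ X) (λ s _ → ⁺-nonneg (x s - t))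
    above : ∀ s → s ∈ X → t ≤ x s
    above s s∈X = 0≤i-j⇒j≤i (≤-trans (⁺-nonneg (x s - t))
      (sumOver-mono-tight X (λ s _ → ≤⁺ (x s - t)) (≤-trans (≤-+-nonneg A 0≤B) A+B≤E) s s∈X))
    below : ∀ s → s ∉ X → x s ≤ t
    below s s∉X = i-j≤0⇒i≤j (≤-trans (≤⁺ (x s - t))
      (sumOver-mono-tight (∁ X) (λ s _ → ⁺-nonneg (x s - t)) B≤Σ0 s (x∉p⇒x∈∁p s∉X)))
      where
      B≤Σ0 : B ≤ sumOver (∁ X) (λ _ → 0ℤ)
      B≤Σ0 = subst (B ≤_) (sym (sumOver-zero (∁ X)))
        (+-cancelˡ-≤ A (≤-trans A+B≤E (subst (sumOver X (λ s → x s - t) ≤_) (sym (+-identityʳ A)) E≤A)))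

Antitone : (Fin n → ℤ) → Set
Antitone u = ∀ {i j} → i Fin.≤ j → u j ≤ u i

↓-antitone : ∀ (x : Fin n → ℤ) → Antitone (x ↓)
↓-antitone x {i} {j} i≤j =
  lookup-mono-≤ (DecTotalOrder.totalOrder (Flip.decTotalOrder ≤-decTotalOrder))
    (≥Sort.sort-↗ (toList (tabulate x)))
    (subst₂ ℕ._≤_ (sym (toℕ-cast _ i)) (sym (toℕ-cast _ j)) i≤j)

Σ⟨_⟩ : (ℤ → ℤ) → List ℤ → ℤ
Σ⟨ g ⟩ xs = foldr _+_ 0ℤ (map g xs)

sumOver-⊤-tabulate : ∀ g (x : Fin n → ℤ) → sumOver ⊤ (g ∘ x) ≡ Σ⟨ g ⟩ (toList (tabulate x))
sumOver-⊤-tabulate {n = zero}  g x = refl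
sumOver-⊤-tabulate {n = suc n} g x = cong (_+_ (g (x zero))) (sumOver-⊤-tabulate g (x ∘ suc))

sumOver-⊤-lookup : ∀ g (xs : List ℤ) (e : n ≡ length xs) →
  sumOver ⊤ (λ i → g (lookup xs (cast e i))) ≡ Σ⟨ g ⟩ xs
sumOver-⊤-lookup {n = zero}  g List.[]       e = refl
sumOver-⊤-lookup {n = suc n} g (x List.∷ xs) e =
  cong (_+_ (g x)) (sumOver-⊤-lookup g xs (cong ℕ.pred e))

sumOver-⊤-↓ : ∀ g (x : Fin n → ℤ) → sumOver ⊤ (g ∘ (x ↓)) ≡ sumOver ⊤ (g ∘ x)
sumOver-⊤-↓ g x = begin
  sumOver ⊤ (g ∘ (x ↓))                  ≡⟨ sumOver-⊤-lookup g (sortDesc xs) (length-sortDesc x) ⟩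
  Σ⟨ g ⟩ (sortDesc xs)                   ≡⟨ ↭ₛ.foldr-commMonoid (setoid ℤ) +-0-isCommutativeMonoid
                                              (↭⇒↭ₛ (↭.map⁺ g (≥Sort.sort-↭ xs))) ⟩
  Σ⟨ g ⟩ xs                              ≡⟨ sumOver-⊤-tabulate g x ⟨
  sumOver ⊤ (g ∘ x)                      ∎
  where
  open ≡-Reasoning
  xs : List ℤ
  xs = toList (tabulate x)

excess-↓ : ∀ t (x : Fin n → ℤ) → excess t (x ↓) ≡ excess t x
excess-↓ t = sumOver-⊤-↓ (λ a → (a - t) ⁺)

excess-≤0 : ∀ {t} {x : Fin n → ℤ} → (∀ s → x s ≤ t) → excess t x ≤ 0ℤ
excess-≤0 {t = t} {x} x≤t = sumOver-nonpos ⊤ (λ s _ → ≤-reflexive (⁺-nonpos-0 (i≤j⇒i-j≤0 (x≤t s))))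

-- If u 0 > v 0 then excess (u 0 − 1) is positive at u but vanishes at v.
decLeq-of-excess : ∀ (u v : Fin n → ℤ) → Antitone u → Antitone v →
  (∀ t → excess t u ≤ excess t v) → DecLeq u v
decLeq-of-excess {n = zero}  u v _ _ _ = inj₁ λ ()
decLeq-of-excess {n = suc n} u v u↘ v↘ u≼v with <-cmp (u zero) (v zero)
... | tri< u₀<v₀ _ _ = inj₂ (zero , (λ _ ()) , u₀<v₀)
... | tri> _ _ v₀<u₀ = ⊥-elim (1≰0 (≤-trans 1≤excess-u (≤-trans (u≼v t) (excess-≤0 v≤t))))
  where
  t : ℤ
  t = u zero - 1ℤ
  1≰0 : ¬ (1ℤ ≤ 0ℤ)
  1≰0 (+≤+ ())
  1≤excess-u : 1ℤ ≤ excess t u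
  1≤excess-u = subst (_≤ excess t u) (cong _⁺ (lemma (u zero)))
    (≤-+-nonneg ((u zero - t) ⁺) (sumOver-nonneg ⊤ (λ s _ → ⁺-nonneg (u (suc s) - t))))
    where
    lemma : ∀ a → a - (a - 1ℤ) ≡ 1ℤ
    lemma = solve-∀
  v≤t : ∀ s → v s ≤ t
  v≤t s = ≤-trans (v↘ {zero} {s} ℕ.z≤n) (<⇒≤-1 v₀<u₀)
... | tri≈ _ u₀≡v₀ _ with decLeq-of-excess (u ∘ suc) (v ∘ suc)
                            (λ i≤j → u↘ (ℕ.s≤s i≤j)) (λ i≤j → v↘ (ℕ.s≤s i≤j))
                            (λ t → +-cancelˡ-≤ ((u zero - t) ⁺)
                                     (subst (λ a → excess t u ≤ (a - t) ⁺ + _) (sym u₀≡v₀) (u≼v t)))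
...   | inj₁ u≡v = inj₁ λ { zero → u₀≡v₀ ; (suc i) → u≡v i }
...   | inj₂ (j , same , uⱼ<vⱼ) =
  inj₂ (suc j , (λ { zero _ → u₀≡v₀ ; (suc i) (ℕ.s≤s i<j) → same i i<j }) , uⱼ<vⱼ)

↓-decLeq-of-excess : ∀ (x y : Fin n → ℤ) → (∀ t → excess t x ≤ excess t y) → DecLeq (x ↓) (y ↓)
↓-decLeq-of-excess x y x≼y = decLeq-of-excess (x ↓) (y ↓) (↓-antitone x) (↓-antitone y)
  (λ t → subst₂ _≤_ (sym (excess-↓ t x)) (sym (excess-↓ t y)) (x≼y t))

DecLeq-antisym : ∀ {u v : Fin n → ℤ} → DecLeq u v → DecLeq v u → ∀ i → u i ≡ v i
DecLeq-antisym (inj₁ u≡v) _          = u≡v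
DecLeq-antisym (inj₂ _)   (inj₁ v≡u) = sym ∘ v≡u
DecLeq-antisym (inj₂ (j , same , uⱼ<vⱼ)) (inj₂ (j′ , same′ , vⱼ′<uⱼ′)) i
  with ℕ.<-cmp (toℕ j) (toℕ j′)
... | tri< j<j′ _ _ = ⊥-elim (<-irrefl (sym (same′ j j<j′)) uⱼ<vⱼ)
... | tri> _ _ j′<j = ⊥-elim (<-irrefl (sym (same j′ j′<j)) vⱼ′<uⱼ′)
... | tri≈ _ j≡j′ _ with toℕ-injective j≡j′
...   | refl = ⊥-elim (<-asym uⱼ<vⱼ vⱼ′<uⱼ′)

-- Unit transfers

⁺-step : ℤ → ℤ
⁺-step u = (u + 1ℤ) ⁺ - u ⁺

⁺-step-nonneg : ∀ {u} → 0ℤ ≤ u → ⁺-step u ≡ 1ℤ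
⁺-step-nonneg {u} 0≤u =
  trans (cong₂ _-_ (⁺-nonneg-id (≤-trans 0≤u (≤-+-nonneg u (+≤+ ℕ.z≤n)))) (⁺-nonneg-id 0≤u))
        (lemma u)
  where
  lemma : ∀ u → u + 1ℤ - u ≡ 1ℤ
  lemma = solve-∀

⁺-step-neg : ∀ {u} → u < 0ℤ → ⁺-step u ≡ 0ℤ
⁺-step-neg {u} u<0 =
  cong₂ _-_ (⁺-nonpos-0 (subst (_≤ 0ℤ) (+-comm 1ℤ u) (i<j⇒suc[i]≤j u<0))) (⁺-nonpos-0 (<⇒≤ u<0))

⁺-step-mono : ∀ {u v} → u ≤ v → ⁺-step u ≤ ⁺-step v
⁺-step-mono {u} {v} u≤v with 0ℤ ≤? u
... | yes 0≤u = ≤-reflexive (trans (⁺-step-nonneg 0≤u) (sym (⁺-step-nonneg (≤-trans 0≤u u≤v))))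
... | no  0≰u = subst (_≤ ⁺-step v) (sym (⁺-step-neg (≰⇒> 0≰u)))
                  (i≤j⇒0≤j-i (⊔-monoˡ-≤ 0ℤ (≤-+-nonneg v (+≤+ ℕ.z≤n))))

addAt : Fin n → ℤ → (Fin n → ℤ) → Fin n → ℤ
addAt zero    c x zero    = x zero + c
addAt zero    c x (suc i) = x (suc i)
addAt (suc a) c x zero    = x zero
addAt (suc a) c x (suc i) = addAt a c (x ∘ suc) i

addAt-≢ : ∀ (a : Fin n) c x {i} → i ≢ a → addAt a c x i ≡ x i
addAt-≢ zero    c x {zero}  i≢a = ⊥-elim (i≢a refl)
addAt-≢ zero    c x {suc i} i≢a = refl
addAt-≢ (suc a) c x {zero}  i≢a = refl
addAt-≢ (suc a) c x {suc i} i≢a = addAt-≢ a c (x ∘ suc) (i≢a ∘ cong suc)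

module _ (φ : ℤ → ℤ) where

  sumOver-map-addAt-∈ : ∀ (a : Fin n) c x Z → a ∈ Z →
    sumOver Z (φ ∘ addAt a c x) ≡ sumOver Z (φ ∘ x) + (φ (x a + c) - φ (x a))
  sumOver-map-addAt-∈ zero    c x (inside ∷ Z)  here        =
    lemma (φ (x zero + c)) (φ (x zero)) (sumOver Z (φ ∘ x ∘ suc))
    where
    lemma : ∀ a b z → a + z ≡ (b + z) + (a - b)
    lemma = solve-∀
  sumOver-map-addAt-∈ (suc a) c x (inside ∷ Z)  (there a∈Z) =
    trans (cong (_+_ (φ (x zero))) (sumOver-map-addAt-∈ a c (x ∘ suc) Z a∈Z)) (sym (+-assoc (φ (x zero)) _ _))
  sumOver-map-addAt-∈ (suc a) c x (outside ∷ Z) (there a∈Z) = sumOver-map-addAt-∈ a c (x ∘ suc) Z a∈Z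

  sumOver-map-addAt-∉ : ∀ (a : Fin n) c x Z → a ∉ Z → sumOver Z (φ ∘ addAt a c x) ≡ sumOver Z (φ ∘ x)
  sumOver-map-addAt-∉ zero    c x (inside ∷ Z)  a∉Z = ⊥-elim (a∉Z here)
  sumOver-map-addAt-∉ zero    c x (outside ∷ Z) a∉Z = refl
  sumOver-map-addAt-∉ (suc a) c x (inside ∷ Z)  a∉Z =
    cong (_+_ (φ (x zero))) (sumOver-map-addAt-∉ a c (x ∘ suc) Z (a∉Z ∘ there))
  sumOver-map-addAt-∉ (suc a) c x (outside ∷ Z) a∉Z = sumOver-map-addAt-∉ a c (x ∘ suc) Z (a∉Z ∘ there)

sumOver-addAt-∈ : ∀ (a : Fin n) c x Z → a ∈ Z → sumOver Z (addAt a c x) ≡ sumOver Z x + c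
sumOver-addAt-∈ a c x Z a∈Z =
  trans (sumOver-map-addAt-∈ id a c x Z a∈Z) (cong (_+_ (sumOver Z x)) (lemma (x a) c))
  where
  lemma : ∀ b c → b + c - b ≡ c
  lemma = solve-∀

module Transfer (x : Fin n → ℤ) {s d : Fin n} (s≢d : s ≢ d) where

  moved : Fin n → ℤ
  moved = addAt s (- 1ℤ) (addAt d 1ℤ x)

  private
    moved-partial : Fin n → ℤ
    moved-partial = addAt d 1ℤ x

    partial-s : moved-partial s ≡ x s
    partial-s = addAt-≢ d 1ℤ x s≢d

    sumOver-partial : ∀ Z → d ∈ Z → sumOver Z moved-partial ≡ sumOver Z x + 1ℤ
    sumOver-partial Z = sumOver-addAt-∈ d 1ℤ x Z

  sumOver-moved-∈∈ : ∀ Z → s ∈ Z → d ∈ Z → sumOver Z moved ≡ sumOver Z x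
  sumOver-moved-∈∈ Z s∈Z d∈Z = begin
    sumOver Z moved                      ≡⟨ sumOver-addAt-∈ s (- 1ℤ) moved-partial Z s∈Z ⟩
    sumOver Z moved-partial + - 1ℤ       ≡⟨ cong (_+ - 1ℤ) (sumOver-partial Z d∈Z) ⟩
    sumOver Z x + 1ℤ + - 1ℤ              ≡⟨ lemma (sumOver Z x) ⟩
    sumOver Z x                          ∎
    where
    open ≡-Reasoning
    lemma : ∀ a → a + 1ℤ + - 1ℤ ≡ a
    lemma = solve-∀

  sumOver-moved-∉ : ∀ Z → s ∉ Z → sumOver Z x ≤ sumOver Z moved
  sumOver-moved-∉ Z s∉Z with d ∈? Z
  ... | yes d∈Z = subst (sumOver Z x ≤_) (sym (trans (sumOver-map-addAt-∉ id s (- 1ℤ) moved-partial Z s∉Z)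
                                                  (sumOver-partial Z d∈Z)))
                    (≤-+-nonneg (sumOver Z x) (+≤+ ℕ.z≤n))
  ... | no  d∉Z = ≤-reflexive (sym (trans (sumOver-map-addAt-∉ id s (- 1ℤ) moved-partial Z s∉Z)
                                          (sumOver-map-addAt-∉ id d 1ℤ x Z d∉Z)))

  sumOver-moved-∈∉ : ∀ Z → s ∈ Z → d ∉ Z → sumOver Z moved ≡ sumOver Z x - 1ℤ
  sumOver-moved-∈∉ Z s∈Z d∉Z =
    trans (sumOver-addAt-∈ s (- 1ℤ) moved-partial Z s∈Z)
          (cong (_- 1ℤ) (sumOver-map-addAt-∉ id d 1ℤ x Z d∉Z))

  excess-moved : ∀ t → excess t moved ≡ excess t x + (⁺-step (x d - t) - ⁺-step (x s - 1ℤ - t))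
  excess-moved t = begin
    excess t moved
      ≡⟨ sumOver-map-addAt-∈ φ s (- 1ℤ) moved-partial ⊤ ∈⊤ ⟩
    excess t moved-partial + (φ (moved-partial s + - 1ℤ) - φ (moved-partial s))
      ≡⟨ cong₂ _+_ (sumOver-map-addAt-∈ φ d 1ℤ x ⊤ ∈⊤)
                   (cong (λ a → φ (a + - 1ℤ) - φ a) partial-s) ⟩
    (excess t x + (φ (x d + 1ℤ) - φ (x d))) + (φ (x s + - 1ℤ) - φ (x s))
      ≡⟨ cong₂ (λ a b → (excess t x + (a - φ (x d))) + (b - φ (x s)))
               (cong _⁺ (shift-up (x d) t)) (cong _⁺ (shift-down (x s) t)) ⟩
    (excess t x + ((x d - t + 1ℤ) ⁺ - φ (x d))) + ((x s - 1ℤ - t) ⁺ - φ (x s))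
      ≡⟨ cong (λ b → (excess t x + ⁺-step (x d - t)) + ((x s - 1ℤ - t) ⁺ - b))
              (cong _⁺ (shift-both (x s) t)) ⟩
    (excess t x + ⁺-step (x d - t)) + ((x s - 1ℤ - t) ⁺ - (x s - 1ℤ - t + 1ℤ) ⁺)
      ≡⟨ regroup (excess t x) (⁺-step (x d - t)) ((x s - 1ℤ - t) ⁺) ((x s - 1ℤ - t + 1ℤ) ⁺) ⟩
    excess t x + (⁺-step (x d - t) - ⁺-step (x s - 1ℤ - t))
      ∎
    where
    open ≡-Reasoning
    φ : ℤ → ℤ
    φ a = (a - t) ⁺
    shift-up : ∀ a t → a + 1ℤ - t ≡ a - t + 1ℤ
    shift-up = solve-∀
    shift-down : ∀ a t → a + - 1ℤ - t ≡ a - 1ℤ - t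
    shift-down = solve-∀
    shift-both : ∀ a t → a - t ≡ a - 1ℤ - t + 1ℤ
    shift-both = solve-∀
    regroup : ∀ e a b c → (e + a) + (b - c) ≡ e + (a - (c - b))
    regroup = solve-∀

  excess-moved-≤ : x d < x s → ∀ t → excess t moved ≤ excess t x
  excess-moved-≤ xd<xs t = subst (_≤ excess t x) (sym (excess-moved t))
    (≤-trans (+-monoʳ-≤ (excess t x) (i≤j⇒i-j≤0 (⁺-step-mono (+-monoˡ-≤ (- t) (<⇒≤-1 xd<xs)))))
             (≤-reflexive (+-identityʳ (excess t x))))

  excess-moved-< : x d + 1ℤ < x s → excess (x s - 1ℤ) moved < excess (x s - 1ℤ) x
  excess-moved-< gap₂ = begin-strict
    excess t moved                                            ≡⟨ excess-moved t ⟩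
    excess t x + (⁺-step (x d - t) - ⁺-step (x s - 1ℤ - t))   ≡⟨ cong₂ (λ a b → excess t x + (a - b))
                                                                   (⁺-step-neg below) (⁺-step-nonneg at) ⟩
    excess t x + - 1ℤ                                          <⟨ +-monoʳ-< (excess t x) (-<+ {0} {0}) ⟩
    excess t x + 0ℤ                                            ≡⟨ +-identityʳ (excess t x) ⟩
    excess t x                                                 ∎
    where
    open ≤-Reasoning
    t : ℤ
    t = x s - 1ℤ
    below : x d - t < 0ℤ
    below = subst (x d - t <_) (+-inverseʳ t)
      (+-monoˡ-< (- t) (suc[i]≤j⇒i<j {i = x d} (subst (_≤ t) (+-comm (x d) 1ℤ) (<⇒≤-1 gap₂))))
    at : 0ℤ ≤ x s - 1ℤ - t
    at = ≤-reflexive (sym (+-inverseʳ t))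

-- Tight sets

≤-squeeze : ∀ {u v a b} → u ≤ a → v ≤ b → a + b ≤ u + v → u ≡ a × v ≡ b
≤-squeeze {u} {v} {a} {b} u≤a v≤b a+b≤u+v =
  ≤-antisym u≤a (+-cancelʳ-≤ b (≤-trans a+b≤u+v (+-monoʳ-≤ u v≤b))) ,
  ≤-antisym v≤b (+-cancelˡ-≤ a (≤-trans a+b≤u+v (+-monoˡ-≤ v u≤a)))

module Tight {p : SetFn n} (sup : Supermodular p) {m : Fin n → ℤ} (m∈B : InB' ⊤ p m) where

  IsTight : Subset n → Set
  IsTight Z = p Z ≡ fin (sumOver Z m)

  p≤m : ∀ Z {a} → p Z ≡ fin a → a ≤ sumOver Z m
  p≤m Z p[Z]≡a = fin-≤∞⁻ (subst (_≤∞ _) p[Z]≡a (proj₂ m∈B Z ⊆⊤))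

  tight-⊤ : IsTight ⊤
  tight-⊤ = proj₁ m∈B

  tight-∩∪ : ∀ {X Y} → IsTight X → IsTight Y → IsTight (X ∩ Y) × IsTight (X ∪ Y)
  tight-∩∪ {X} {Y} tX tY with ≤∞-+∞-finite (p (X ∩ Y)) (p (X ∪ Y)) (sup X Y _ _ tX tY)
  ... | u , v , p[X∩Y]≡u , p[X∪Y]≡v , ΣX+ΣY≤u+v =
    trans p[X∩Y]≡u (cong fin (proj₁ squeeze)) , trans p[X∪Y]≡v (cong fin (proj₂ squeeze))
    where
    squeeze : u ≡ sumOver (X ∩ Y) m × v ≡ sumOver (X ∪ Y) m
    squeeze = ≤-squeeze (p≤m (X ∩ Y) p[X∩Y]≡u) (p≤m (X ∪ Y) p[X∪Y]≡v)
      (subst (_≤ u + v) (trans (sym (sumOver-∪+∩ X Y m)) (+-comm (sumOver (X ∪ Y) m) _)) ΣX+ΣY≤u+v)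

  unseparated-transfer-∈B : ∀ {s d} (s≢d : s ≢ d) → ¬ (∃[ Z ] IsTight Z × s ∈ Z × d ∉ Z) →
    InB' ⊤ p (Transfer.moved m s≢d)
  unseparated-transfer-∈B {s} {d} s≢d ∄Z =
    trans tight-⊤ (cong fin (sym (sumOver-moved-∈∈ ⊤ ∈⊤ ∈⊤))) , moved-lower
    where
    open Transfer m s≢d
    moved-lower : ∀ Z → Z ⊆ ⊤ → p Z ≤∞ fin (sumOver Z moved)
    moved-lower Z _ with p Z in p[Z]≡e
    ... | -∞    = -∞≤
    ... | fin z = fin≤ (bound (s ∈? Z) (d ∈? Z))
      where
      z≤ΣZ : z ≤ sumOver Z m
      z≤ΣZ = p≤m Z p[Z]≡e
      bound : Dec (s ∈ Z) → Dec (d ∈ Z) → z ≤ sumOver Z moved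
      bound (no s∉Z)  _         = ≤-trans z≤ΣZ (sumOver-moved-∉ Z s∉Z)
      bound (yes s∈Z) (yes d∈Z) = subst (z ≤_) (sym (sumOver-moved-∈∈ Z s∈Z d∈Z)) z≤ΣZ
      bound (yes s∈Z) (no d∉Z)  = subst (z ≤_) (sym (sumOver-moved-∈∉ Z s∈Z d∉Z))
        (<⇒≤-1 (≤∧≢⇒< z≤ΣZ λ z≡ΣZ → ∄Z (Z , trans p[Z]≡e (cong fin z≡ΣZ) , s∈Z , d∉Z)))

module DecreasinglyMinimal {p : SetFn n} (sup : Supermodular p) (p∅ : p ∅ ≡ fin 0ℤ)
  {m : Fin n → ℤ} (m-min : DecMinIn (InB' ⊤ p) m) where

  open Tight sup (proj₁ m-min) public

  tight-∅ : IsTight ∅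
  tight-∅ = trans p∅ (cong fin (sym (sumOver-∅ m)))

  -- Otherwise moving a unit from s to d stays in B but lowers the excess.
  tight-separating : ∀ {s d} → m d + 1ℤ < m s → ∃[ Z ] IsTight Z × s ∈ Z × d ∉ Z
  tight-separating {s} {d} gap₂
    with anySubset? (λ Z → (p Z ≟∞ fin (sumOver Z m)) ×-dec (s ∈? Z) ×-dec ¬? (d ∈? Z))
  ... | yes separating = separating
  ... | no ∄Z = ⊥-elim (<-irrefl same-excess (excess-moved-< gap₂))
    where
    md<ms : m d < m s
    md<ms = ≤-<-trans (≤-+-nonneg (m d) (+≤+ ℕ.z≤n)) gap₂

    s≢d : s ≢ d
    s≢d refl = <-irrefl refl md<ms

    open Transfer m s≢d

    same-↓ : ∀ i → (m ↓) i ≡ (moved ↓) i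
    same-↓ = DecLeq-antisym (proj₂ m-min moved (unseparated-transfer-∈B s≢d ∄Z))
                            (↓-decLeq-of-excess moved m (excess-moved-≤ md<ms))

    same-excess : excess (m s - 1ℤ) moved ≡ excess (m s - 1ℤ) m
    same-excess = begin
      excess t moved          ≡⟨ excess-↓ t moved ⟨
      excess t (moved ↓)      ≡⟨ sumOver-cong ⊤ (λ i _ → cong (λ a → (a - t) ⁺) (same-↓ i)) ⟨
      excess t (m ↓)          ≡⟨ excess-↓ t m ⟩
      excess t m              ∎
      where
      open ≡-Reasoning
      t : ℤ
      t = m s - 1ℤ

  -- X is the union over all a with m a > t of intersections of tight sets
  -- separating a from every coordinate below t.
  tight-levelSet : ∀ t → ∃[ X ] IsTight X × IsLevelSet t m X
  tight-levelSet t = X , X-tight , X-above , X-below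
    where
    core : ∀ a → ∃[ Z ] IsTight Z × (t < m a → a ∈ Z) × (∀ s → s ∈ Z → t ≤ m s)
    core a with t <? m a
    ... | no  t≮ma = ∅ , tight-∅ , (λ t<ma → ⊥-elim (t≮ma t<ma)) , (λ s s∈∅ → ⊥-elim (∉⊥ s∈∅))
    ... | yes t<ma = ⊤ ∩⋂ F , ∩⋂-closed IsTight (proj₁ ∘₂ tight-∩∪) tight-⊤ (proj₁ ∘ proj₂ ∘ avoiding)
                   , (λ _ → ∈-∩⋂⁺ ∈⊤ (proj₁ ∘ proj₂ ∘ proj₂ ∘ avoiding)) , above
      where
      avoiding : ∀ d → ∃[ Z ] IsTight Z × a ∈ Z × (m d < t → d ∉ Z)
      avoiding d with m d <? t
      ... | yes md<t = let Z , tZ , a∈Z , d∉Z = tight-separating (<-≤-trans (+-monoˡ-< 1ℤ md<t)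
                                                                  (subst (_≤ m a) (+-comm 1ℤ t) (i<j⇒suc[i]≤j t<ma)))
                       in Z , tZ , a∈Z , λ _ → d∉Z
      ... | no  md≮t = ⊤ , tight-⊤ , ∈⊤ , λ md<t → ⊥-elim (md≮t md<t)
      F : Fin n → Subset n
      F = proj₁ ∘ avoiding
      above : ∀ s → s ∈ ⊤ ∩⋂ F → t ≤ m s
      above s s∈ with m s <? t
      ... | yes ms<t = ⊥-elim (proj₂ (proj₂ (proj₂ (avoiding s))) ms<t (proj₂ (∈-∩⋂⁻ ⊤ F s∈) s))
      ... | no  ms≮t = ≮⇒≥ ms≮t

    G : Fin n → Subset n
    G = proj₁ ∘ core
    X : Subset n
    X = ∅ ∪⋃ G
    X-tight : IsTight X
    X-tight = ∪⋃-closed IsTight (proj₂ ∘₂ tight-∩∪) tight-∅ (proj₁ ∘ proj₂ ∘ core)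
    X-above : ∀ s → s ∈ X → t ≤ m s
    X-above s s∈X with ∈-∪⋃⁻ ∅ G s∈X
    ... | inj₁ s∈∅       = ⊥-elim (∉⊥ s∈∅)
    ... | inj₂ (a , s∈G) = proj₂ (proj₂ (proj₂ (core a))) s s∈G
    X-below : ∀ s → s ∉ X → m s ≤ t
    X-below s s∉X with m s ≤? t
    ... | yes ms≤t = ms≤t
    ... | no  ms≰t = ⊥-elim (s∉X (∈-∪⋃⁺ (inj₂ (s , proj₁ (proj₂ (proj₂ (core s))) (≰⇒> ms≰t)))))

  maximizer-tight-levelSet : ∀ t Y {c} → p Y ≡ fin c →
    (∀ X {a} → p X ≡ fin a → a - t * card X ≤ c - t * card Y) →
    IsLevelSet t m Y × sumOver Y m ≡ c
  maximizer-tight-levelSet t Y {c} p[Y]≡c Y-max with tight-levelSet t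
  ... | X , X-tight , X-level =
    excess-≤⇒levelSet t m Y (≤-trans excess≤c (+-monoˡ-≤ _ c≤ΣY)) ,
    ≤-antisym (+-cancelʳ-≤ _ (≤-trans (excess-≥ t m Y) excess≤c)) c≤ΣY
    where
    excess≤c : excess t m ≤ c - t * card Y
    excess≤c = subst (_≤ c - t * card Y) (sym (excess-levelSet t m X X-level)) (Y-max X X-tight)
    c≤ΣY : c ≤ sumOver Y m
    c≤ΣY = p≤m Y p[Y]≡c

-- The canonical chain

ceilDiv∞-card-≤ : ∀ {X : Subset n} → Nonempty X → ∀ a b →
  ceilDiv∞ (fin a) ∣ X ∣ ≤∞ fin b ⇔ a ≤ b * card X
ceilDiv∞-card-≤ X≠∅ a b =
  let k , ∣X∣≡1+k = nonempty⇒∣∣≡suc X≠∅ in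
  subst (λ m → ceilDiv∞ (fin a) m ≤∞ fin b ⇔ a ≤ b * + m) (sym ∣X∣≡1+k) (ceilDiv∞-≤ a k b)

module _ (p : SetFn n) {C : Subset n} {c : ℤ} (p[C]≡c : p C ≡ fin c) (b : ℤ) where

  hFn-value : ∀ X {a} → p (X ∪ C) ≡ fin a → hFn p C b X ≡ fin ((a - c) - (b - 1ℤ) * card X)
  hFn-value X p[X∪C]≡a rewrite p[X∪C]≡a | p[C]≡c = refl

  hFn-finite⁻ : ∀ X {x} → hFn p C b X ≡ fin x →
    ∃[ a ] p (X ∪ C) ≡ fin a × (a - c) - (b - 1ℤ) * card X ≡ x
  hFn-finite⁻ X h≡x rewrite p[C]≡c with p (X ∪ C)
  hFn-finite⁻ X () | -∞
  ... | fin a = a , refl , fin-injective h≡x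

  hFn-maximizer-finite : ∀ {S} → IsMaximizer p C b S → ∃[ a ] p (S ∪ C) ≡ fin a
  hFn-maximizer-finite {S} (_ , S-max) =
    let _ , h[S]≡x = ≤∞-finite⁻ (subst (_≤∞ hFn p C b S) h[∅] (S-max ∅ (⊥-elim ∘ ∉⊥)))
        a , p[S∪C]≡a , _ = hFn-finite⁻ S h[S]≡x
    in a , p[S∪C]≡a
    where
    h[∅] : hFn p C b ∅ ≡ fin ((c - c) - (b - 1ℤ) * card (∅ {n}))
    h[∅] = hFn-value ∅ (trans (cong p (∪-identityˡ C)) p[C]≡c)

  hFn-supermodular : Supermodular p → Supermodular (hFn p C b)
  hFn-supermodular sup X Y x y h[X]≡x h[Y]≡y
    with hFn-finite⁻ X h[X]≡x | hFn-finite⁻ Y h[Y]≡y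
  ... | a₁ , p₁ , refl | a₂ , p₂ , refl
    with ≤∞-+∞-finite _ _ (sup (X ∪ C) (Y ∪ C) a₁ a₂ p₁ p₂)
  ... | u , v , p∩≡u , p∪≡v , a₁+a₂≤u+v =
    subst₂ (λ e f → fin _ ≤∞ e +∞ f)
      (sym (hFn-value (X ∩ Y) (trans (cong p (∪-distribʳ-∩ C X Y)) p∩≡u)))
      (sym (hFn-value (X ∪ Y) (trans (cong p (sym (∪-distribʳ-∪ X Y C))) p∪≡v)))
      (fin≤ (≤-by-gap (+-mono-≤ (i≤j⇒0≤j-i a₁+a₂≤u+v) (≤-reflexive (sym modular))) (regroup a₁ a₂ u v c k (card X) (card Y) (card (X ∩ Y)) (card (X ∪ Y)))))
    where
    k : ℤ
    k = b - 1ℤ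
    modular : k * ((card X + card Y) - (card (X ∪ Y) + card (X ∩ Y))) ≡ 0ℤ
    modular = trans (cong (λ z → k * ((card X + card Y) - z)) (card-∪+∩ X Y))
                    (trans (cong (k *_) (+-inverseʳ (card X + card Y))) (*-zeroʳ k))
    regroup : ∀ a₁ a₂ u v c k x y i w →
      ((u - c) - k * i + ((v - c) - k * w)) - (((a₁ - c) - k * x) + ((a₂ - c) - k * y))
        ≡ ((u + v) - (a₁ + a₂)) + k * ((x + y) - (w + i))
    regroup = solve-∀

-- Junk value 0 at -∞; only applied to the finite values p (C j).
toℤ : ℤ∞ → ℤ
toℤ -∞      = 0ℤ
toℤ (fin a) = a

toℤ-fin : ∀ {e a} → e ≡ fin a → e ≡ fin (toℤ e)
toℤ-fin refl = refl

module Canonical {p : SetFn n} (adm : Admissible p) (q : ℕ) (C : ℕ → Subset n) (β : ℕ → ℤ)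
  (Sp : ℕ → Subset n) (canon : IsCanonical p q C β Sp) where

  p∅ : p ∅ ≡ fin 0ℤ
  p∅ = proj₁ adm

  sup : Supermodular p
  sup = proj₂ (proj₂ adm)

  C₀≡∅ : C 0 ≡ ∅
  C₀≡∅ = proj₁ canon

  C-q≡⊤ : C q ≡ ⊤
  C-q≡⊤ = proj₁ (proj₂ canon)

  canonical-step : ∀ j → j ℕ.< q → CanonicalStep p (C j) (β (suc j)) (Sp (suc j))
  canonical-step j j<q = proj₁ (proj₂ (proj₂ (proj₂ canon)) j j<q)

  C-suc : ∀ j → j ℕ.< q → C (suc j) ≡ C j ∪ Sp (suc j)
  C-suc j j<q = proj₂ (proj₂ (proj₂ (proj₂ canon)) j j<q)

  S-maximizer-of-finite : ∀ j → j ℕ.< q → ∀ {c} → p (C j) ≡ fin c →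
    IsMaximizer p (C j) (β (suc j)) (Sp (suc j))
  S-maximizer-of-finite j j<q p[C]≡c =
    ⋂maximizers-isMax (hFn-supermodular p p[C]≡c (β (suc j)) sup) (proj₂ (canonical-step j j<q))

  C-finite : ∀ j → j ℕ.≤ q → ∃[ c ] p (C j) ≡ fin c
  C-finite zero    _   = 0ℤ , trans (cong p C₀≡∅) p∅
  C-finite (suc j) j<q =
    let c , p[C]≡c = C-finite j (ℕ.<⇒≤ j<q)
        a , p[S∪C]≡a = hFn-maximizer-finite p p[C]≡c (β (suc j)) (S-maximizer-of-finite j j<q p[C]≡c)
    in a , trans (cong p (trans (C-suc j j<q) (∪-comm (C j) (Sp (suc j))))) p[S∪C]≡a

  c : ℕ → ℤ
  c j = toℤ (p (C j))

  p-C : ∀ j → j ℕ.≤ q → p (C j) ≡ fin (c j)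
  p-C j j≤q = toℤ-fin (proj₂ (C-finite j j≤q))

  c₀≡0 : c 0 ≡ 0ℤ
  c₀≡0 = cong toℤ (trans (cong p C₀≡∅) p∅)

  S-maximizer : ∀ j → j ℕ.< q → IsMaximizer p (C j) (β (suc j)) (Sp (suc j))
  S-maximizer j j<q = S-maximizer-of-finite j j<q (p-C j (ℕ.<⇒≤ j<q))

  S⊆∁C : ∀ j → j ℕ.< q → Sp (suc j) ⊆ ∁ (C j)
  S⊆∁C j j<q = proj₁ (S-maximizer j j<q)

  C⊆∁S : ∀ j → j ℕ.< q → C j ⊆ ∁ (Sp (suc j))
  C⊆∁S j j<q s∈C = x∉p⇒x∈∁p λ s∈S → x∈∁p⇒x∉p (S⊆∁C j j<q s∈S) s∈C

  S⊆C-suc : ∀ j → j ℕ.< q → Sp (suc j) ⊆ C (suc j)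
  S⊆C-suc j j<q s∈S = subst (_ ∈_) (sym (C-suc j j<q)) (x∈p∪q⁺ (inj₂ s∈S))

  p-S∪C : ∀ j → j ℕ.< q → p (Sp (suc j) ∪ C j) ≡ fin (c (suc j))
  p-S∪C j j<q = trans (cong p (trans (∪-comm (Sp (suc j)) (C j)) (sym (C-suc j j<q)))) (p-C (suc j) j<q)

  sumOver-C-suc : ∀ j → j ℕ.< q → ∀ f → sumOver (C (suc j)) f ≡ sumOver (C j) f + sumOver (Sp (suc j)) f
  sumOver-C-suc j j<q f =
    trans (cong (λ Z → sumOver Z f) (C-suc j j<q)) (sumOver-disjoint-∪ (C j) (Sp (suc j)) f (C⊆∁S j j<q))

  card-C-suc : ∀ j → j ℕ.< q → card (C (suc j)) ≡ card (C j) + card (Sp (suc j))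
  card-C-suc j j<q =
    trans (cong card (C-suc j j<q)) (card-disjoint-∪ (C j) (Sp (suc j)) (C⊆∁S j j<q))

  ∩∁C⊆S : ∀ j → j ℕ.< q → ∀ {W} → W ⊆ C (suc j) → W ∩ ∁ (C j) ⊆ Sp (suc j)
  ∩∁C⊆S j j<q {W} W⊆C s∈ with x∈p∩q⁻ W (∁ (C j)) s∈
  ... | s∈W , s∈∁C with x∈p∪q⁻ (C j) (Sp (suc j)) (subst (_ ∈_) (C-suc j j<q) (W⊆C s∈W))
  ...   | inj₁ s∈C = ⊥-elim (x∈∁p⇒x∉p s∈∁C s∈C)
  ...   | inj₂ s∈S = s∈S

  supermodular-split : ∀ j → j ℕ.≤ q → ∀ W {w} → p W ≡ fin w →
    ∃[ u ] ∃[ v ] p (W ∩ C j) ≡ fin u × p ((W ∩ ∁ (C j)) ∪ C j) ≡ fin v × w + c j ≤ u + v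
  supermodular-split j j≤q W p[W]≡w
    with ≤∞-+∞-finite _ _ (sup W (C j) _ _ p[W]≡w (p-C j j≤q))
  ... | u , v , p∩≡u , p∪≡v , w+c≤u+v =
    u , v , p∩≡u , trans (cong p (∩∁-∪ W (C j))) p∪≡v , w+c≤u+v

  h-bound : ∀ j → j ℕ.< q → ∀ Y {a} → Y ⊆ ∁ (C j) → p (Y ∪ C j) ≡ fin a →
    (a - c j) - (β (suc j) - 1ℤ) * card Y ≤ (c (suc j) - c j) - (β (suc j) - 1ℤ) * card (Sp (suc j))
  h-bound j j<q Y Y⊆∁C p[Y∪C]≡a = fin-≤∞⁻ (subst₂ _≤∞_
    (hFn-value p (p-C j (ℕ.<⇒≤ j<q)) (β (suc j)) Y p[Y∪C]≡a)
    (hFn-value p (p-C j (ℕ.<⇒≤ j<q)) (β (suc j)) (Sp (suc j)) (p-S∪C j j<q))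
    (proj₂ (S-maximizer j j<q) Y Y⊆∁C))

  increment-bound : ∀ j → j ℕ.< q → ∀ X {a} → p (X ∪ C j) ≡ fin a →
    a - c j ≤ β (suc j) * card (X ∩ ∁ (C j))
  increment-bound j j<q X {a} p[X∪C]≡a with nonempty? (X ∩ ∁ (C j))
  ... | yes X′≠∅ = Equivalence.to (ceilDiv∞-card-≤ X′≠∅ (a - c j) (β (suc j)))
    (subst (λ e → ceilDiv∞ e ∣ X ∩ ∁ (C j) ∣ ≤∞ fin (β (suc j)))
       (cong₂ diff∞ (trans (cong p (∩∁-∪ X (C j))) p[X∪C]≡a) (p-C j (ℕ.<⇒≤ j<q)))
       (proj₁ (proj₁ (canonical-step j j<q)) _ X′≠∅ (p∩q⊆q X (∁ (C j)))))
  ... | no X′≢∅ = ≤-reflexive (begin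
    a - c j                          ≡⟨ cong (_- c j) a≡c ⟩
    c j - c j                        ≡⟨ +-inverseʳ (c j) ⟩
    0ℤ                               ≡⟨ *-zeroʳ (β (suc j)) ⟨
    β (suc j) * 0ℤ                   ≡⟨ cong (β (suc j) *_) (card-∅ n) ⟨
    β (suc j) * card (∅ {n})         ≡⟨ cong (λ Z → β (suc j) * card Z) X′≡∅ ⟨
    β (suc j) * card (X ∩ ∁ (C j))   ∎)
    where
    open ≡-Reasoning
    X′≡∅ : X ∩ ∁ (C j) ≡ ∅
    X′≡∅ = Empty-unique X′≢∅
    a≡c : a ≡ c j
    a≡c = fin-injective (begin
      fin a                   ≡⟨ p[X∪C]≡a ⟨
      p (X ∪ C j)             ≡⟨ cong p (∩∁-∪ X (C j)) ⟨
      p (X ∩ ∁ (C j) ∪ C j)   ≡⟨ cong (λ Z → p (Z ∪ C j)) X′≡∅ ⟩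
      p (∅ ∪ C j)             ≡⟨ cong p (∪-identityˡ (C j)) ⟩
      p (C j)                 ≡⟨ p-C j (ℕ.<⇒≤ j<q) ⟩
      fin (c j)               ∎)

  C⊆C-suc : ∀ j → j ℕ.< q → C j ⊆ C (suc j)
  C⊆C-suc j j<q s∈C = subst (_ ∈_) (sym (C-suc j j<q)) (x∈p∪q⁺ (inj₁ s∈C))

  -- S_{j+1} maximizes h, so adding any X outside C_{j+1} gains at most β_{j+1} − 1 per element.
  increment-bound-suc : ∀ j → j ℕ.< q → ∀ X {a} → X ⊆ ∁ (C (suc j)) → p (X ∪ C (suc j)) ≡ fin a →
    a - c (suc j) ≤ (β (suc j) - 1ℤ) * card X
  increment-bound-suc j j<q X {a} X⊆∁C′ p[X∪C′]≡a =
    ≤-by-gap (i≤j⇒0≤j-i h-bound′) (regroup a (c j) (c (suc j)) k (card X) (card S))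
    where
    k : ℤ
    k = β (suc j) - 1ℤ
    S : Subset n
    S = Sp (suc j)
    X⊆∁S : X ⊆ ∁ S
    X⊆∁S s∈X = x∉p⇒x∈∁p λ s∈S → x∈∁p⇒x∉p (X⊆∁C′ s∈X) (S⊆C-suc j j<q s∈S)
    X∪S⊆∁C : X ∪ S ⊆ ∁ (C j)
    X∪S⊆∁C s∈ with x∈p∪q⁻ X S s∈
    ... | inj₁ s∈X = x∉p⇒x∈∁p λ s∈C → x∈∁p⇒x∉p (X⊆∁C′ s∈X) (C⊆C-suc j j<q s∈C)
    ... | inj₂ s∈S = S⊆∁C j j<q s∈S
    p[X∪S∪C]≡a : p ((X ∪ S) ∪ C j) ≡ fin a
    p[X∪S∪C]≡a = trans (cong p (begin
      (X ∪ S) ∪ C j    ≡⟨ ∪-assoc X S (C j) ⟩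
      X ∪ (S ∪ C j)    ≡⟨ cong (X ∪_) (∪-comm S (C j)) ⟩
      X ∪ (C j ∪ S)    ≡⟨ cong (X ∪_) (C-suc j j<q) ⟨
      X ∪ C (suc j)    ∎)) p[X∪C′]≡a
      where open ≡-Reasoning
    h-bound′ : (a - c j) - k * (card X + card S) ≤ (c (suc j) - c j) - k * card S
    h-bound′ = subst (λ z → (a - c j) - k * z ≤ (c (suc j) - c j) - k * card S) (card-disjoint-∪ X S X⊆∁S)
                 (h-bound j j<q (X ∪ S) X∪S⊆∁C p[X∪S∪C]≡a)
    regroup : ∀ a c c′ k x s →
      k * x - (a - c′) ≡ ((c′ - c) - k * s) - ((a - c) - k * (x + s))
    regroup = solve-∀

  β-step : ∀ j → suc j ℕ.< q → β (suc (suc j)) ≤ β (suc j) - 1ℤ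
  β-step j 1+j<q with proj₂ (proj₁ (canonical-step (suc j) 1+j<q))
  ... | X , X≠∅ , X⊆∁C′ , ⌈⌉≡β′ with p (X ∪ C (suc j)) in p[X∪C′]≡e
  β-step j 1+j<q | X , X≠∅ , X⊆∁C′ , () | -∞
  ... | fin a = fin-≤∞⁻ (subst (_≤∞ fin (β (suc j) - 1ℤ)) ⌈⌉≡β′′
                  (Equivalence.from (ceilDiv∞-card-≤ X≠∅ (a - c (suc j)) (β (suc j) - 1ℤ))
                     (increment-bound-suc j (ℕ.<-trans (ℕ.n<1+n j) 1+j<q) X X⊆∁C′ p[X∪C′]≡e)))
    where
    ⌈⌉≡β′′ : ceilDiv∞ (fin (a - c (suc j))) ∣ X ∣ ≡ fin (β (suc (suc j)))
    ⌈⌉≡β′′ = subst (λ e → ceilDiv∞ (diff∞ (fin a) e) ∣ X ∣ ≡ fin (β (suc (suc j))))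
               (p-C (suc j) (ℕ.<⇒≤ 1+j<q)) ⌈⌉≡β′

  β-antitone : ∀ {i j} → i ℕ.≤ j → j ℕ.< q → β (suc j) ≤ β (suc i)
  β-antitone {i} {j} i≤j j<q with ℕ.m≤n⇒m<n∨m≡n i≤j
  ... | inj₂ refl = ≤-refl
  ... | inj₁ i<j with j
  ...   | suc j′ = ≤-trans (β-step j′ j<q)
                     (≤-trans (i-1≤i (β (suc j′))) (β-antitone (ℕ.≤-pred i<j) (ℕ.<-trans (ℕ.n<1+n j′) j<q)))

  β-strict : ∀ {i j} → i ℕ.< j → j ℕ.< q → β (suc j) ≤ β (suc i) - 1ℤ
  β-strict {i} {j} i<j j<q =
    ≤-trans (β-antitone i<j j<q) (β-step i (ℕ.≤-<-trans i<j j<q))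

  S-increment-bound : ∀ j → j ℕ.< q → ∀ t → t ≤ β (suc j) - 1ℤ → ∀ Y {v} → Y ⊆ Sp (suc j) →
    p (Y ∪ C j) ≡ fin v → (v - c j) - t * card Y ≤ (c (suc j) - c j) - t * card (Sp (suc j))
  S-increment-bound j j<q t t≤k Y {v} Y⊆S p[Y∪C]≡v =
    ≤-by-gap (+-mono-≤ (i≤j⇒0≤j-i (h-bound j j<q Y (S⊆∁C j j<q ∘ Y⊆S) p[Y∪C]≡v))
                    (0≤* (i≤j⇒0≤j-i t≤k) (i≤j⇒0≤j-i (card-mono Y⊆S))))
      (regroup v (c j) (c (suc j)) (β (suc j) - 1ℤ) t (card Y) (card (Sp (suc j))))
    where
    regroup : ∀ v c c′ k t y s →
      ((c′ - c) - t * s) - ((v - c) - t * y)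
        ≡ (((c′ - c) - k * s) - ((v - c) - k * y)) + (k - t) * (s - y)
    regroup = solve-∀

  inner-bound : ∀ j → j ℕ.≤ q → ∀ t → (∀ i → i ℕ.< j → t ≤ β (suc i) - 1ℤ) →
    ∀ Y {a} → Y ⊆ C j → p Y ≡ fin a → a - t * card Y ≤ c j - t * card (C j)
  inner-bound zero _ t _ Y {a} Y⊆C₀ p[Y]≡a = ≤-reflexive (begin
    a - t * card Y        ≡⟨ cong₂ (λ x Z → x - t * card Z) a≡0 Y≡∅ ⟩
    0ℤ - t * card (∅ {n}) ≡⟨ cong₂ (λ x Z → x - t * card Z) c₀≡0 C₀≡∅ ⟨
    c 0 - t * card (C 0)  ∎)
    where
    open ≡-Reasoning
    Y≡∅ : Y ≡ ∅
    Y≡∅ = Empty-unique λ (s , s∈Y) → ∉⊥ (subst (s ∈_) C₀≡∅ (Y⊆C₀ s∈Y))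
    a≡0 : a ≡ 0ℤ
    a≡0 = fin-injective (trans (sym p[Y]≡a) (trans (cong p Y≡∅) p∅))
  inner-bound (suc j) j<q t t≤k Y {a} Y⊆C p[Y]≡a
    with supermodular-split j (ℕ.<⇒≤ j<q) Y p[Y]≡a
  ... | u , v , p∩≡u , p∪≡v , a+c≤u+v =
    subst₂ (λ y z → a - t * y ≤ c (suc j) - t * z) (sym (card-split Y (C j))) (sym (card-C-suc j j<q))
      (≤-by-gap (+-mono-≤ (i≤j⇒0≤j-i a+c≤u+v) (+-mono-≤ (i≤j⇒0≤j-i inner) (i≤j⇒0≤j-i outer)))
         (regroup a u v (c j) (c (suc j)) t (card (C j)) (card (Sp (suc j)))
                  (card (Y ∩ C j)) (card (Y ∩ ∁ (C j)))))
    where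
    inner : u - t * card (Y ∩ C j) ≤ c j - t * card (C j)
    inner = inner-bound j (ℕ.<⇒≤ j<q) t (λ i i<j → t≤k i (ℕ.m<n⇒m<1+n i<j))
              (Y ∩ C j) (p∩q⊆q Y (C j)) p∩≡u
    outer : (v - c j) - t * card (Y ∩ ∁ (C j)) ≤ (c (suc j) - c j) - t * card (Sp (suc j))
    outer = S-increment-bound j j<q t (t≤k j (ℕ.n<1+n j)) _ (∩∁C⊆S j j<q Y⊆C) p∪≡v
    regroup : ∀ a u v c c′ t C S A X →
      (c′ - t * (C + S)) - (a - t * (A + X))
        ≡ ((u + v) - (a + c)) + (((c - t * C) - (u - t * A)) + (((c′ - c) - t * S) - ((v - c) - t * X)))
    regroup = solve-∀

  outside-bound : ∀ j t → j ℕ.≤ q → (j ℕ.< q → β (suc j) ≤ t) →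
    ∀ X {v} → p ((X ∩ ∁ (C j)) ∪ C j) ≡ fin v → v - c j ≤ t * card (X ∩ ∁ (C j))
  outside-bound j t j≤q β≤t X {v} p∪≡v with ℕ.m≤n⇒m<n∨m≡n j≤q
  ... | inj₁ j<q = ≤-trans (increment-bound j j<q X (trans (cong p (sym (∩∁-∪ X (C j)))) p∪≡v))
                           (*-monoʳ-≤-nonNeg (card (X ∩ ∁ (C j))) (β≤t j<q))
  ... | inj₂ refl = ≤-reflexive (begin
    v - c q                  ≡⟨ cong (_- c q) (fin-injective (trans (sym p∪≡v) p[X′∪C]≡c)) ⟩
    c q - c q                ≡⟨ +-inverseʳ (c q) ⟩
    0ℤ                       ≡⟨ *-zeroʳ t ⟨
    t * 0ℤ                   ≡⟨ cong (t *_) (card-∅ n) ⟨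
    t * card (∅ {n})         ≡⟨ cong (λ Z → t * card Z) X′≡∅ ⟨
    t * card (X ∩ ∁ (C q))   ∎)
    where
    open ≡-Reasoning
    X′≡∅ : X ∩ ∁ (C q) ≡ ∅
    X′≡∅ = Empty-unique λ (s , s∈) →
      x∈∁p⇒x∉p (proj₂ (x∈p∩q⁻ X (∁ (C q)) s∈)) (subst (s ∈_) (sym C-q≡⊤) ∈⊤)
    p[X′∪C]≡c : p ((X ∩ ∁ (C q)) ∪ C q) ≡ fin (c q)
    p[X′∪C]≡c = trans (cong (λ Z → p (Z ∪ C q)) X′≡∅) (trans (cong p (∪-identityˡ (C q))) (p-C q j≤q))

  -- In the paper's indexing: C_j maximizes p(X) − t|X| when β_{j+1} ≤ t ≤ β_j − 1.
  C-maximizes : ∀ j t → j ℕ.≤ q → (∀ i → i ℕ.< j → t ≤ β (suc i) - 1ℤ) → (j ℕ.< q → β (suc j) ≤ t) →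
    ∀ X {a} → p X ≡ fin a → a - t * card X ≤ c j - t * card (C j)
  C-maximizes j t j≤q t≤k β≤t X {a} p[X]≡a with supermodular-split j j≤q X p[X]≡a
  ... | u , v , p∩≡u , p∪≡v , a+c≤u+v =
    subst (λ y → a - t * y ≤ c j - t * card (C j)) (sym (card-split X (C j)))
      (≤-by-gap (+-mono-≤ (i≤j⇒0≤j-i a+c≤u+v) (+-mono-≤ (i≤j⇒0≤j-i inner) (i≤j⇒0≤j-i outer)))
         (regroup a u v (c j) t (card (C j)) (card (X ∩ C j)) (card (X ∩ ∁ (C j)))))
    where
    inner : u - t * card (X ∩ C j) ≤ c j - t * card (C j)
    inner = inner-bound j j≤q t t≤k (X ∩ C j) (p∩q⊆q X (C j)) p∩≡u
    outer : v - c j ≤ t * card (X ∩ ∁ (C j))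
    outer = outside-bound j t j≤q β≤t X p∪≡v
    regroup : ∀ a u v c t C A X →
      (c - t * C) - (a - t * (A + X))
        ≡ ((u + v) - (a + c)) + (((c - t * C) - (u - t * A)) + (t * X - (v - c)))
    regroup = solve-∀

  ∈C-full : ∀ {j} → j ≡ q → ∀ s → s ∈ C j
  ∈C-full refl s = subst (s ∈_) (sym C-q≡⊤) ∈⊤

  j+suc≡q⇒j<q : ∀ {j d} → j ℕ.+ suc d ≡ q → j ℕ.< q
  j+suc≡q⇒j<q {j} {d} j+d≡q = subst (j ℕ.<_) j+d≡q (ℕ.m<m+n j ℕ.z<s)

  ∉C-suc : ∀ {j} → j ℕ.< q → ∀ {s} → s ∉ C j → s ∉ Sp (suc j) → s ∉ C (suc j)
  ∉C-suc {j} j<q {s} s∉C s∉S s∈C′ with x∈p∪q⁻ (C j) (Sp (suc j)) (subst (s ∈_) (C-suc j j<q) s∈C′)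
  ... | inj₁ s∈C = s∉C s∈C
  ... | inj₂ s∈S = s∉S s∈S

  pᵢ-value : ∀ j → j ℕ.≤ q → ∀ Z {a} → p (Z ∪ C j) ≡ fin a → pᵢ p (C j) Z ≡ fin (a - c j)
  pᵢ-value j j≤q Z p[Z∪C]≡a = cong₂ diff∞ p[Z∪C]≡a (p-C j j≤q)

  sumOver-S : ∀ j → j ℕ.< q → ∀ {f} → sumOver (C (suc j)) f ≡ c (suc j) → sumOver (C j) f ≡ c j →
    sumOver (Sp (suc j)) f ≡ c (suc j) - c j
  sumOver-S j j<q {f} ΣC′≡c′ ΣC≡c = begin
    sumOver (Sp (suc j)) f
      ≡⟨ lemma _ (sumOver (C j) f) ⟩
    (sumOver (C j) f + sumOver (Sp (suc j)) f) - sumOver (C j) f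
      ≡⟨ cong₂ _-_ (trans (sym (sumOver-C-suc j j<q f)) ΣC′≡c′) ΣC≡c ⟩
    c (suc j) - c j
      ∎
    where
    open ≡-Reasoning
    lemma : ∀ a b → a ≡ (b + a) - b
    lemma = solve-∀

  InB• : (Fin n → ℤ) → Set
  InB• m = ∀ j → j ℕ.< q → InB' (Sp (suc j)) (pᵢ p (C j)) m × InT (Sp (suc j)) (β (suc j)) m

  module Backward {m : Fin n → ℤ} (m∈B• : InB• m) where

    sumOver-C : ∀ j → j ℕ.≤ q → sumOver (C j) m ≡ c j
    sumOver-C zero    _   = trans (cong (λ Z → sumOver Z m) C₀≡∅) (trans (sumOver-∅ m) (sym c₀≡0))
    sumOver-C (suc j) j<q = begin
      sumOver (C (suc j)) m                          ≡⟨ sumOver-C-suc j j<q m ⟩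
      sumOver (C j) m + sumOver (Sp (suc j)) m       ≡⟨ cong₂ _+_ (sumOver-C j (ℕ.<⇒≤ j<q)) ΣS≡ ⟩
      c j + (c (suc j) - c j)                        ≡⟨ lemma (c j) (c (suc j)) ⟩
      c (suc j)                                      ∎
      where
      open ≡-Reasoning
      ΣS≡ : sumOver (Sp (suc j)) m ≡ c (suc j) - c j
      ΣS≡ = sym (fin-injective (trans (sym (pᵢ-value j (ℕ.<⇒≤ j<q) (Sp (suc j)) (p-S∪C j j<q)))
                                      (proj₁ (proj₁ (m∈B• j j<q)))))
      lemma : ∀ a b → a + (b - a) ≡ b
      lemma = solve-∀

    lower : ∀ j → j ℕ.≤ q → ∀ W → W ⊆ C j → p W ≤∞ fin (sumOver W m)
    lower zero    _   W W⊆C₀ = subst (λ Z → p Z ≤∞ fin (sumOver Z m)) (sym W≡∅)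
                                 (subst₂ _≤∞_ (sym p∅) (cong fin (sym (sumOver-∅ m))) ≤∞-refl)
      where
      W≡∅ : W ≡ ∅
      W≡∅ = Empty-unique λ (s , s∈W) → ∉⊥ (subst (s ∈_) C₀≡∅ (W⊆C₀ s∈W))
    lower (suc j) j<q W W⊆C with p W in p[W]≡e
    ... | -∞    = -∞≤
    ... | fin w with supermodular-split j (ℕ.<⇒≤ j<q) W p[W]≡e
    ...   | u , v , p∩≡u , p∪≡v , w+c≤u+v =
      fin≤ (subst (w ≤_) (sym (sumOver-split W (C j) m))
              (≤-by-gap (+-mono-≤ (i≤j⇒0≤j-i w+c≤u+v) (+-mono-≤ (i≤j⇒0≤j-i inner) (i≤j⇒0≤j-i outer))) (regroup w (c j) u v (sumOver (W ∩ C j) m) (sumOver (W ∩ ∁ (C j)) m))))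
      where
      inner : u ≤ sumOver (W ∩ C j) m
      inner = fin-≤∞⁻ (subst (_≤∞ _) p∩≡u (lower j (ℕ.<⇒≤ j<q) (W ∩ C j) (p∩q⊆q W (C j))))
      outer : v - c j ≤ sumOver (W ∩ ∁ (C j)) m
      outer = fin-≤∞⁻ (subst (_≤∞ _) (pᵢ-value j (ℕ.<⇒≤ j<q) (W ∩ ∁ (C j)) p∪≡v)
                (proj₂ (proj₁ (m∈B• j j<q)) (W ∩ ∁ (C j)) (∩∁C⊆S j j<q W⊆C)))
      regroup : ∀ w c u v a b → (a + b) - w ≡ ((u + v) - (w + c)) + ((a - u) + (b - (v - c)))
      regroup = solve-∀

    m∈B : InB' ⊤ p m
    m∈B = trans (cong p (sym C-q≡⊤)) (trans (p-C q ℕ.≤-refl)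
            (cong fin (trans (sym (sumOver-C q ℕ.≤-refl)) (cong (λ Z → sumOver Z m) C-q≡⊤))))
        , λ Z _ → lower q ℕ.≤-refl Z (λ s∈Z → subst (_ ∈_) (sym C-q≡⊤) ∈⊤)

    ∉C⇒∈S : ∀ d j → j ℕ.+ d ≡ q → ∀ {s} → s ∉ C j → ∃[ k ] j ℕ.≤ k × k ℕ.< q × s ∈ Sp (suc k)
    ∉C⇒∈S zero    j j+0≡q {s} s∉C = ⊥-elim (s∉C (∈C-full (trans (sym (ℕ.+-identityʳ j)) j+0≡q) s))
    ∉C⇒∈S (suc d) j j+d≡q {s} s∉C with s ∈? Sp (suc j)
    ... | yes s∈S = j , ℕ.≤-refl , j+suc≡q⇒j<q j+d≡q , s∈S
    ... | no  s∉S with ∉C⇒∈S d (suc j) (trans (sym (ℕ.+-suc j d)) j+d≡q) (∉C-suc (j+suc≡q⇒j<q j+d≡q) s∉C s∉S)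
    ...   | k , 1+j≤k , k<q , s∈S′ = k , ℕ.<⇒≤ 1+j≤k , k<q , s∈S′

    ∉C⇒≤β : ∀ j → j ℕ.< q → ∀ {s} → s ∉ C j → m s ≤ β (suc j)
    ∉C⇒≤β j j<q s∉C with ∉C⇒∈S (q ℕ.∸ j) j (ℕ.m+[n∸m]≡n (ℕ.<⇒≤ j<q)) s∉C
    ... | k , j≤k , k<q , s∈S = ≤-trans (proj₂ (proj₂ (m∈B• k k<q) _ s∈S)) (β-antitone j≤k k<q)

    C-levelSet : ∀ t → ∃[ j ] j ℕ.≤ q × IsLevelSet t m (C j)
    C-levelSet t = search q 0 refl λ s s∈C₀ → ⊥-elim (∉⊥ (subst (s ∈_) C₀≡∅ s∈C₀))
      where
      search : ∀ d j → j ℕ.+ d ≡ q → (∀ s → s ∈ C j → t ≤ m s) →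
        ∃[ j′ ] j′ ℕ.≤ q × IsLevelSet t m (C j′)
      search d j j+d≡q above with any? (λ s → ¬? (s ∈? C j) ×-dec (t <? m s))
      ... | no ∄s = j , subst (j ℕ.≤_) j+d≡q (ℕ.m≤m+n j d) , above , below
        where
        below : ∀ s → s ∉ C j → m s ≤ t
        below s s∉C with m s ≤? t
        ... | yes ms≤t = ms≤t
        ... | no  ms≰t = ⊥-elim (∄s (s , s∉C , ≰⇒> ms≰t))
      search zero    j j+0≡q above | yes (s , s∉C , _) =
        ⊥-elim (s∉C (∈C-full (trans (sym (ℕ.+-identityʳ j)) j+0≡q) s))
      search (suc d) j j+d≡q above | yes (s , s∉C , t<ms) =
        search d (suc j) (trans (sym (ℕ.+-suc j d)) j+d≡q) above′
        where
        j<q : j ℕ.< q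
        j<q = j+suc≡q⇒j<q j+d≡q
        t≤β-1 : t ≤ β (suc j) - 1ℤ
        t≤β-1 = <⇒≤-1 (<-≤-trans t<ms (∉C⇒≤β j j<q s∉C))
        above′ : ∀ s → s ∈ C (suc j) → t ≤ m s
        above′ s s∈C′ with x∈p∪q⁻ (C j) (Sp (suc j)) (subst (s ∈_) (C-suc j j<q) s∈C′)
        ... | inj₁ s∈C = above s s∈C
        ... | inj₂ s∈S = ≤-trans t≤β-1 (proj₁ (proj₂ (m∈B• j j<q) s s∈S))

    excess-minimal : ∀ {y} → InB' ⊤ p y → ∀ t → excess t m ≤ excess t y
    excess-minimal {y} y∈B t with C-levelSet t
    ... | j , j≤q , level = begin
      excess t m                       ≡⟨ excess-levelSet t m (C j) level ⟩
      sumOver (C j) m - t * card (C j) ≡⟨ cong (_- t * card (C j)) (sumOver-C j j≤q) ⟩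
      c j - t * card (C j)             ≤⟨ +-monoˡ-≤ _ (fin-≤∞⁻ (subst (_≤∞ _) (p-C j j≤q) (proj₂ y∈B (C j) ⊆⊤))) ⟩
      sumOver (C j) y - t * card (C j) ≤⟨ excess-≥ t y (C j) ⟩
      excess t y                       ∎
      where open ≤-Reasoning

    decreasingly-minimal : DecMinIn (InB' ⊤ p) m
    decreasingly-minimal = m∈B , λ y y∈B → ↓-decLeq-of-excess m y (excess-minimal y∈B)

  forward : ∀ {m} → DecMinIn (InB' ⊤ p) m → InB• m
  forward {m} m-min j j<q = (pᵢ[S]≡ΣS , pᵢ≤Σ) , λ s s∈S →
    proj₁ (proj₁ at-β-1) s (S⊆C-suc j j<q s∈S) , proj₂ (proj₁ at-β) s (x∈∁p⇒x∉p (S⊆∁C j j<q s∈S))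
    where
    open DecreasinglyMinimal sup p∅ m-min
    j≤q : j ℕ.≤ q
    j≤q = ℕ.<⇒≤ j<q

    at-β : IsLevelSet (β (suc j)) m (C j) × sumOver (C j) m ≡ c j
    at-β = maximizer-tight-levelSet (β (suc j)) (C j) (p-C j j≤q)
      (C-maximizes j (β (suc j)) j≤q (λ i i<j → β-strict i<j j<q) (λ _ → ≤-refl))

    at-β-1 : IsLevelSet (β (suc j) - 1ℤ) m (C (suc j)) × sumOver (C (suc j)) m ≡ c (suc j)
    at-β-1 = maximizer-tight-levelSet (β (suc j) - 1ℤ) (C (suc j)) (p-C (suc j) j<q)
      (C-maximizes (suc j) (β (suc j) - 1ℤ) j<q
        (λ i i<1+j → +-monoˡ-≤ (- 1ℤ) (β-antitone (ℕ.≤-pred i<1+j) j<q)) (β-step j))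

    pᵢ[S]≡ΣS : pᵢ p (C j) (Sp (suc j)) ≡ fin (sumOver (Sp (suc j)) m)
    pᵢ[S]≡ΣS = trans (pᵢ-value j j≤q (Sp (suc j)) (p-S∪C j j<q))
                     (cong fin (sym (sumOver-S j j<q (proj₂ at-β-1) (proj₂ at-β))))

    pᵢ≤Σ : ∀ Z → Z ⊆ Sp (suc j) → pᵢ p (C j) Z ≤∞ fin (sumOver Z m)
    pᵢ≤Σ Z Z⊆S = bound (p (Z ∪ C j)) refl
      where
      bound : ∀ e → p (Z ∪ C j) ≡ e → pᵢ p (C j) Z ≤∞ fin (sumOver Z m)
      bound -∞      p[Z∪C]≡-∞ = subst (λ e → diff∞ e (p (C j)) ≤∞ _) (sym p[Z∪C]≡-∞) -∞≤
      bound (fin a) p[Z∪C]≡a  = subst (_≤∞ _) (sym (pᵢ-value j j≤q Z p[Z∪C]≡a))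
        (fin≤ (subst (λ z → a - c j ≤ z) (lemma (sumOver Z m) (c j))
          (+-monoˡ-≤ (- c j) (subst (a ≤_) ΣZ∪C≡ (p≤m (Z ∪ C j) p[Z∪C]≡a)))))
        where
        ΣZ∪C≡ : sumOver (Z ∪ C j) m ≡ sumOver Z m + c j
        ΣZ∪C≡ = trans (sumOver-disjoint-∪ Z (C j) m (S⊆∁C j j<q ∘ Z⊆S)) (cong (_+_ (sumOver Z m)) (proj₂ at-β))
        lemma : ∀ a b → a + b - b ≡ a
        lemma = solve-∀

theorem5p3 : ∀ (n : ℕ) → 0 ℕ.< n → (p : SetFn n) → Admissible p →
    ∀ (q : ℕ) (C : ℕ → Subset n) (β : ℕ → ℤ) (Sp : ℕ → Subset n) →
    IsCanonical p q C β Sp →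
    ∀ (m : Fin n → ℤ) →
      DecMinIn (InB' ⊤ p) m ⇔
      (∀ (j : ℕ) → j ℕ.< q →
        InB' (Sp (suc j)) (pᵢ p (C j)) m × InT (Sp (suc j)) (β (suc j)) m)
theorem5p3 n _ p adm q C β Sp canon m = mk⇔ forward Backward.decreasingly-minimal
  where open Canonical adm q C β Sp canon
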